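{- For any positive integer $n$, there exists a 2-dimensional temperature-2 zig-zag tile system whose set of north/south glue types has size bounded by a constant independent of $n$, and which uniquely assembles a $\log n\times n$ rectangle. Moreover, this system can be designed so that a unique, otherwise unused glue appears on the east side of the tile placed at the northeast corner of the rectangle.
   Context: Abstract Tile Assembly Model (2D). A tile type is a Wang tile $(\mathrm{north},\mathrm{east},\mathrm{south},\mathrm{west})$ of glue types from an alphabet containing a null glue; each glue has a non-negative integer strength, glues only bind to identical glues, and null has strength 0. A tile system $\langle T,s,\tau\rangle$ has finite tile set $T$, seed $s\in T$ and temperature $\tau$. A tile attaches at an empty position if the total strength of its glues matching abutting neighbour glues is at least $\tau$; assembly starts from $s$ at the origin. A system uniquely assembles (uniquely produces) a shape $S$ if every produced assembly can be grown into a terminal assembly (one to which no tile can attach) whose set of occupied positions is $S$. Zig-zag systems: a 2D tile system is zig-zag if (1) its assembly sequence is unique, with $(x(i),y(i))$ the position of the $i$-th attached tile, and (2) for every $i$: if $y(i-1)$ is even then either ($x(i)=x(i-1)+1$ and $y(i)=y(i-1)$) or $y(i)=y(i-1)+1$; if $y(i-1)$ is odd then either ($x(i)=x(i-1)-1$ and $y(i)=y(i-1)$) or $y(i)=y(i-1)+1$. The north/south glue set is the set of glue types appearing on north or south sides of tile types in $T$. -}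

module Defs where

open import Data.Nat as ℕ using (ℕ; zero; suc; _≤_)
open import Data.Integer as ℤ using (ℤ; +_)
open import Data.Integer.Divisibility using (_∣_)
import Data.Integer.Properties as ℤP
import Data.Nat.Properties as ℕP
open import Data.Nat.Logarithm using (⌊log₂_⌋)
open import Data.Product using (Σ; ∃; _×_; _,_)
open import Data.Sum using (_⊎_)
open import Data.Maybe using (Maybe; just; nothing)
import Data.Maybe as Maybe
open import Data.List using (List; map; _++_; length; deduplicate)
open import Data.List.Membership.Propositional using (_∈_)
open import Relation.Nullary using (¬_; yes; no)
open import Relation.Binary.PropositionalEquality using (_≡_; _≢_)

Glue : Set
Glue = ℕ

null : Glue
null = 0

record TileType : Set where
  constructor tile
  field
    north east south west : Glue
open TileType public

record TileSystem : Set where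
  field
    tiles    : List TileType
    seed     : TileType
    seed∈T   : seed ∈ tiles
    τ        : ℕ
    str      : Glue → ℕ
    str-null : str null ≡ 0
open TileSystem public

Pos : Set
Pos = ℤ × ℤ

Assembly : Set
Assembly = Pos → Maybe TileType

_≟Pos_ : (p q : Pos) → Relation.Nullary.Dec (p ≡ q)
(x , y) ≟Pos (x' , y') with x ℤP.≟ x' | y ℤP.≟ y'
... | yes Relation.Binary.PropositionalEquality.refl | yes Relation.Binary.PropositionalEquality.refl = yes Relation.Binary.PropositionalEquality.refl
... | no ne | _ = no λ { Relation.Binary.PropositionalEquality.refl → ne Relation.Binary.PropositionalEquality.refl }
... | yes _ | no ne = no λ { Relation.Binary.PropositionalEquality.refl → ne Relation.Binary.PropositionalEquality.refl }

place : Assembly → Pos → TileType → Assembly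
place α p t q with q ≟Pos p
... | yes _ = just t
... | no  _ = α q

seedAssembly : TileSystem → Assembly
seedAssembly 𝒯 q with q ≟Pos (+ 0 , + 0)
... | yes _ = just (seed 𝒯)
... | no  _ = nothing

bond : TileSystem → Glue → Maybe Glue → ℕ
bond 𝒯 g nothing = 0
bond 𝒯 g (just h) with g ℕP.≟ h
... | yes _ = str 𝒯 g
... | no  _ = 0

strength : TileSystem → Assembly → Pos → TileType → ℕ
strength 𝒯 α (x , y) t =
    bond 𝒯 (north t) (Maybe.map south (α (x , y ℤ.+ ℤ.1ℤ)))
  ℕ.+ bond 𝒯 (east t) (Maybe.map west (α (x ℤ.+ ℤ.1ℤ , y)))
  ℕ.+ bond 𝒯 (south t) (Maybe.map north (α (x , y ℤ.- ℤ.1ℤ)))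
  ℕ.+ bond 𝒯 (west t) (Maybe.map east (α (x ℤ.- ℤ.1ℤ , y)))

CanAttach : TileSystem → Assembly → Pos → TileType → Set
CanAttach 𝒯 α p t = (t ∈ tiles 𝒯) × (α p ≡ nothing) × (τ 𝒯 ≤ strength 𝒯 α p t)

data Grows (𝒯 : TileSystem) : Assembly → Assembly → Set where
  done : ∀ {α} → Grows 𝒯 α α
  step : ∀ {α β p t} → CanAttach 𝒯 α p t → Grows 𝒯 (place α p t) β → Grows 𝒯 α β

Produced : TileSystem → Assembly → Set
Produced 𝒯 α = Grows 𝒯 (seedAssembly 𝒯) α

Terminal : TileSystem → Assembly → Set
Terminal 𝒯 α = ∀ p t → ¬ CanAttach 𝒯 α p t

Occupied : Assembly → Pos → Set
Occupied α p = ∃ λ t → α p ≡ just t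

HasShape : Assembly → (Pos → Set) → Set
HasShape α S = ∀ p → (Occupied α p → S p) × (S p → Occupied α p)

UniquelyAssembles : TileSystem → (Pos → Set) → Set
UniquelyAssembles 𝒯 S =
  ∀ α → Produced 𝒯 α → ∃ λ β → Grows 𝒯 α β × Terminal 𝒯 β × HasShape β S

Rect : ℤ → ℤ → ℕ → ℕ → Pos → Set
Rect a b w h (x , y) = (a ℤ.≤ x) × (x ℤ.< a ℤ.+ + w) × (b ℤ.≤ y) × (y ℤ.< b ℤ.+ + h)

data Seq (𝒯 : TileSystem) : Assembly → Pos → Set where
  start  : Seq 𝒯 (seedAssembly 𝒯) (+ 0 , + 0)
  attach : ∀ {α q p t} → Seq 𝒯 α q → CanAttach 𝒯 α p t → Seq 𝒯 (place α p t) p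

Even : ℤ → Set
Even y = + 2 ∣ y

ZigZagMove : Pos → Pos → Set
ZigZagMove (x , y) (x' , y') =
  (Even y → ((x' ≡ x ℤ.+ ℤ.1ℤ) × (y' ≡ y)) ⊎ (y' ≡ y ℤ.+ ℤ.1ℤ)) ×
  (¬ Even y → ((x' ≡ x ℤ.- ℤ.1ℤ) × (y' ≡ y)) ⊎ (y' ≡ y ℤ.+ ℤ.1ℤ))

IsZigZag : TileSystem → Set
IsZigZag 𝒯 =
  (∀ α q → Seq 𝒯 α q → ∀ p t p' t' →
     CanAttach 𝒯 α p t → CanAttach 𝒯 α p' t' → (p ≡ p') × (t ≡ t')) ×
  (∀ α q → Seq 𝒯 α q → ∀ p t → CanAttach 𝒯 α p t → ZigZagMove q p)

nsGlues : TileSystem → List Glue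
nsGlues 𝒯 = deduplicate ℕP._≟_ (map north (tiles 𝒯) ++ map south (tiles 𝒯))

#nsGlues : TileSystem → ℕ
#nsGlues 𝒯 = length (nsGlues 𝒯)

OnlyEastOf : TileSystem → Glue → TileType → Set
OnlyEastOf 𝒯 γ t =
  (γ ≢ null) × (east t ≡ γ) ×
  (∀ u → u ∈ tiles 𝒯 →
     (north u ≢ γ) × (south u ≢ γ) × (west u ≢ γ) × (east u ≡ γ → u ≡ t))

neCorner : ℤ → ℤ → ℕ → ℕ → Pos
neCorner a b w h = (a ℤ.+ + w ℤ.- ℤ.1ℤ , b ℤ.+ + h ℤ.- ℤ.1ℤ)

module Submission where

-- Row y of the rectangle (0 ≤ y < n) is a strip of width 2L + 2, where
-- L = ⌊log₂ n⌋ + 1, assembled boustrophedon-wise: even rows eastward, odd rows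
-- westward, each row starting right above the end of the previous one.  The
-- first L steps of a middle row read the binary digits of y, one per step, from
-- strength-1 north glues of the row below, cooperating with strength-1
-- horizontal glues that remember the bits read so far.  Once all L bits are
-- known the row knows y, and the rest of it is hard-wired by strength-2
-- horizontal glues unique to (y, step); on the way it writes the bits of y + 1
-- into its north glues and ends with a strength-2 start glue for the next row,
-- recording only its parity and whether it is the top row.  Hence all north and
-- south glues come from a fixed set of seven (null, two bits, four start
-- glues), while at every stage exactly one tile type can attach, at exactly one
-- position: the next cell of the snake.

open import Defs
open import Data.Nat
open import Data.Nat.Properties
open import Data.Nat.DivMod
open import Data.Nat.Divisibility using (_∣_; divides; ∣-refl; ∣m∣n⇒∣m+n; ∣m+n∣m⇒∣n; ∣⇒≤)
open import Data.Nat.Logarithm using (⌊log₂_⌋; ⌊log₂⌋-mono-≤; ⌊log₂[2^n]⌋≡n)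
open import Data.Nat.Tactic.RingSolver using (solve-∀)
open import Data.Bool using (Bool; true; false; not; _∧_; if_then_else_)
import Data.Bool as Bool
open import Data.Bool.Properties using (not-involutive; ¬-not)
open import Data.Integer using (ℤ)
open import Data.Integer as ℤ using (+_; -[1+_])
open import Data.Maybe using (Maybe; just; nothing)
import Data.Maybe as Maybe
open import Data.List using (List; []; _∷_; map; upTo; _++_; length; filter; deduplicate)
open import Data.List.Properties using (filter-all; filter-accept; filter-reject)
open import Data.List.Relation.Unary.All as All using (All; []; _∷_)
import Data.List.Relation.Unary.All.Properties as All
import Data.List.Relation.Unary.AllPairs.Properties as AllPairs
open import Data.List.Relation.Unary.Unique.Propositional using (Unique; []; _∷_)
open import Data.List.Relation.Unary.Unique.DecPropositional.Properties using (deduplicate-!)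
open import Data.List.Membership.Propositional using (_∈_)
open import Data.List.Membership.Propositional.Properties using (∈-map⁺; ∈-map⁻; ∈-upTo⁺; ∈-upTo⁻; ∈-++⁻; ∈-deduplicate⁻)
open import Data.Product using (∃; _×_; _,_; proj₁; proj₂)
open import Data.Sum using (_⊎_; inj₁; inj₂; [_,_]′)
open import Function using (id; _∘_; case_of_)
open import Relation.Nullary using (¬_; ¬?; Dec; yes; no; does; contradiction)
open import Relation.Nullary.Decidable using (dec-true; dec-false; _×-dec_)
open import Relation.Binary.Definitions using (tri<; tri≈; tri>)
open import Relation.Binary.PropositionalEquality

divMod-unique : ∀ {w a a′} b b′ → a < w → a′ < w → a + b * w ≡ a′ + b′ * w → a ≡ a′ × b ≡ b′
divMod-unique {w@(suc _)} {a} {a′} b b′ a<w a′<w eq =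
  a≡a′ , *-cancelʳ-≡ b b′ w (+-cancelˡ-≡ a _ _ (trans eq (cong (_+ b′ * w) (sym a≡a′))))
  where
  a≡a′ : a ≡ a′
  a≡a′ = begin
    a                 ≡⟨ m<n⇒m%n≡m a<w ⟨
    a % w             ≡⟨ [m+kn]%n≡m%n a b w ⟨
    (a + b * w) % w   ≡⟨ cong (_% w) eq ⟩
    (a′ + b′ * w) % w ≡⟨ [m+kn]%n≡m%n a′ b′ w ⟩
    a′ % w            ≡⟨ m<n⇒m%n≡m a′<w ⟩
    a′                ∎
    where open ≡-Reasoning

n<2^[1+⌊log₂n⌋] : ∀ n → n < 2 ^ suc ⌊log₂ n ⌋
n<2^[1+⌊log₂n⌋] n = ≰⇒> λ 2^[1+k]≤n →
  1+n≰n (subst (_≤ ⌊log₂ n ⌋) (⌊log₂[2^n]⌋≡n (suc ⌊log₂ n ⌋)) (⌊log₂⌋-mono-≤ 2^[1+k]≤n))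

divMod-of : ∀ {w a} .{{_ : NonZero w}} b → a < w → (a + b * w) % w ≡ a × (a + b * w) / w ≡ b
divMod-of {w} {a} b a<w = divMod-unique (k / w) b (m%n<n k w) a<w (sym (m≡m%n+[m/n]*n k w))
  where k = a + b * w

1≤right : ∀ {a b} → a ≤ 1 → 2 ≤ a + b → 1 ≤ b
1≤right {b = zero}  a≤1 2≤a+b = contradiction (≤-trans 2≤a+b (≤-reflexive (+-identityʳ _))) (<⇒≱ (s≤s a≤1))
1≤right {b = suc b} _   _     = s≤s z≤n

1≤both : ∀ {a b} → a ≤ 1 → b ≤ 1 → 2 ≤ a + b → 1 ≤ a × 1 ≤ b
1≤both {a} {b} a≤1 b≤1 2≤ = 1≤right b≤1 (subst (2 ≤_) (+-comm a b) 2≤) , 1≤right a≤1 2≤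

2≤third : ∀ {a b c d} → a ≡ 0 → b ≡ 0 → d ≡ 0 → 2 ≤ a + b + c + d → 2 ≤ c
2≤third {c = c} refl refl refl 2≤ = subst (2 ≤_) (+-identityʳ c) 2≤

shiftR : ℕ → ℕ → ℕ
shiftR y zero    = y
shiftR y (suc i) = shiftR y i / 2

bit : ℕ → ℕ → ℕ
bit y i = shiftR y i % 2

lowBits : ℕ → ℕ → ℕ
lowBits y zero    = 0
lowBits y (suc i) = lowBits y i + bit y i * 2 ^ i

lowBits+shiftR : ∀ y i → y ≡ lowBits y i + shiftR y i * 2 ^ i
lowBits+shiftR y zero    = sym (*-identityʳ y)
lowBits+shiftR y (suc i) = begin
  y                                                   ≡⟨ lowBits+shiftR y i ⟩
  lowBits y i + h * 2 ^ i                             ≡⟨ cong (λ z → lowBits y i + z * 2 ^ i) (m≡m%n+[m/n]*n h 2) ⟩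
  lowBits y i + (h % 2 + h / 2 * 2) * 2 ^ i           ≡⟨ cong (_+_ (lowBits y i)) (*-distribʳ-+ (2 ^ i) (h % 2) (h / 2 * 2)) ⟩
  lowBits y i + (h % 2 * 2 ^ i + h / 2 * 2 * 2 ^ i)   ≡⟨ +-assoc (lowBits y i) _ _ ⟨
  lowBits y (suc i) + h / 2 * 2 * 2 ^ i               ≡⟨ cong (_+_ (lowBits y (suc i))) (*-assoc (h / 2) 2 (2 ^ i)) ⟩
  lowBits y (suc i) + shiftR y (suc i) * 2 ^ suc i    ∎
  where
  open ≡-Reasoning
  h = shiftR y i

lowBits-complete : ∀ {y} L → y < 2 ^ L → lowBits y L ≡ y
lowBits-complete {y} L y<2^L with shiftR y L in eq
... | zero  = sym (trans (lowBits+shiftR y L) (trans (cong (λ z → lowBits y L + z * 2 ^ L) eq) (+-identityʳ _)))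
... | suc h = contradiction (begin
  2 ^ L                             ≤⟨ m≤m+n (2 ^ L) (h * 2 ^ L) ⟩
  suc h * 2 ^ L                     ≡⟨ cong (_* 2 ^ L) eq ⟨
  shiftR y L * 2 ^ L                ≤⟨ m≤n+m _ (lowBits y L) ⟩
  lowBits y L + shiftR y L * 2 ^ L  ≡⟨ lowBits+shiftR y L ⟨
  y                                 ∎) (<⇒≱ y<2^L)
  where open ≤-Reasoning

private
  without : ℕ → List ℕ → List ℕ
  without v = filter (λ x → ¬? (x ≟ v))

  length≤1+length-without : ∀ v {xs} → Unique xs → length xs ≤ suc (length (without v xs))
  length≤1+length-without v {[]} [] = z≤n
  length≤1+length-without v {x ∷ xs} (x∉xs ∷ xs!) with x ≟ v
  ... | yes refl = s≤s (≤-reflexive (cong length (sym (trans (filter-reject (λ x → ¬? (x ≟ v)) (λ v≢v → v≢v refl))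
                       (filter-all (λ x → ¬? (x ≟ v)) (All.map (λ v≢y y≡v → v≢y (sym y≡v)) x∉xs))))))
  ... | no x≢v   = ≤-trans (s≤s (length≤1+length-without v xs!))
                           (≤-reflexive (cong (suc ∘ length) (sym (filter-accept (λ x → ¬? (x ≟ v)) x≢v))))

unique-bounded-length : ∀ b {xs} → Unique xs → All (_< b) xs → length xs ≤ b
unique-bounded-length zero    {[]}    _  _          = z≤n
unique-bounded-length zero    {_ ∷ _} _  (() ∷ _)
unique-bounded-length (suc b) {xs}    xs! xs<1+b =
  ≤-trans (length≤1+length-without b xs!)
          (s≤s (unique-bounded-length b (AllPairs.filter⁺ _ xs!)
                 (All.zipWith (λ (x<1+b , x≢b) → ≤∧≢⇒< (s≤s⁻¹ x<1+b) x≢b) (All.filter⁺ _ xs<1+b , All.all-filter _ xs))))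

length-deduplicate≤ : ∀ b xs → All (_< b) xs → length (deduplicate _≟_ xs) ≤ b
length-deduplicate≤ b xs xs<b =
  unique-bounded-length b (deduplicate-! _≟_ xs) (All.tabulate (λ x∈ → All.lookup xs<b (∈-deduplicate⁻ _≟_ xs x∈)))

if-true : ∀ {A : Set} {b} {x y : A} → b ≡ true → (if b then x else y) ≡ x
if-true refl = refl

if-false : ∀ {A : Set} {b} {x y : A} → b ≡ false → (if b then x else y) ≡ y
if-false refl = refl

bool-cases : ∀ {P : Set} b → (b ≡ true → P) → (b ≡ false → P) → P
bool-cases true  t _ = t refl
bool-cases false _ f = f refl

does-true : ∀ {A : Set} (a? : Dec A) → does a? ≡ true → A
does-true (yes a) _ = a

does-false : ∀ {A : Set} (a? : Dec A) → does a? ≡ false → ¬ A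
does-false (no ¬a) _ = ¬a

isEven : ℕ → Bool
isEven zero    = true
isEven (suc y) = not (isEven y)

isEven⇒even : ∀ y → isEven y ≡ true → 2 ∣ y
isEven⇒even zero          _ = divides 0 refl
isEven⇒even (suc (suc y)) e = ∣m∣n⇒∣m+n (∣-refl {2}) (isEven⇒even y (trans (sym (not-involutive (isEven y))) e))

isOdd⇒¬even : ∀ y → isEven y ≡ false → ¬ 2 ∣ y
isOdd⇒¬even (suc zero)    _ 2∣1 with s≤s () ← ∣⇒≤ 2∣1
isOdd⇒¬even (suc (suc y)) e 2∣y+2 =
  isOdd⇒¬even y (trans (sym (not-involutive (isEven y))) e) (∣m+n∣m⇒∣n 2∣y+2 (∣-refl {2}))

module _ (𝒯 : TileSystem) where
  bond≤str : ∀ g h → bond 𝒯 g (just h) ≤ str 𝒯 h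
  bond≤str g h with g ≟ h
  ... | yes refl = ≤-refl
  ... | no  _    = z≤n

  bond-match : ∀ g h → 1 ≤ bond 𝒯 g (just h) → g ≡ h
  bond-match g h _ with g ≟ h
  bond-match g h _  | yes g≡h = g≡h
  bond-match g h () | no  _

  bond-self : ∀ g → bond 𝒯 g (just g) ≡ str 𝒯 g
  bond-self g with g ≟ g
  ... | yes _   = refl
  ... | no  g≢g = contradiction refl g≢g

  bond-weak : ∀ g h → str 𝒯 h ≡ 0 → bond 𝒯 g (just h) ≡ 0
  bond-weak g h h≡0 = n≤0⇒n≡0 (subst (bond 𝒯 g (just h) ≤_) h≡0 (bond≤str g h))

strength-resp-≗ : ∀ 𝒯 {α β} → α ≗ β → ∀ p t → strength 𝒯 α p t ≡ strength 𝒯 β p t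
strength-resp-≗ 𝒯 α≗β (x , y) t
  rewrite α≗β (x , y ℤ.+ ℤ.1ℤ) | α≗β (x ℤ.+ ℤ.1ℤ , y) | α≗β (x , y ℤ.- ℤ.1ℤ) | α≗β (x ℤ.- ℤ.1ℤ , y) = refl

canAttach-resp-≗ : ∀ {𝒯 α β} → α ≗ β → ∀ {p t} → CanAttach 𝒯 α p t → CanAttach 𝒯 β p t
canAttach-resp-≗ {𝒯} α≗β {p} {t} (t∈T , free , τ≤) =
  t∈T , trans (sym (α≗β p)) free , subst (τ 𝒯 ≤_) (strength-resp-≗ 𝒯 α≗β p t) τ≤

place-resp-≗ : ∀ {α β} → α ≗ β → ∀ p t → place α p t ≗ place β p t
place-resp-≗ α≗β p t q with q ≟Pos p
... | yes _ = refl
... | no  _ = α≗β q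

-- A system whose producible assemblies are exactly the prefixes stage k of one
-- fixed attachment order.
module SequentialAssembly
  (𝒯 : TileSystem) (N : ℕ) (1≤N : 1 ≤ N)
  (stage : ℕ → Assembly) (pos : ℕ → Pos) (tileAt : ℕ → TileType)
  (pos₀ : pos 0 ≡ (+ 0 , + 0))
  (seed≗stage₁ : seedAssembly 𝒯 ≗ stage 1)
  (place≗stage : ∀ {k} → k < N → place (stage k) (pos k) (tileAt k) ≗ stage (suc k))
  (canAttach-next : ∀ {k} → 1 ≤ k → k < N → CanAttach 𝒯 (stage k) (pos k) (tileAt k))
  (canAttach-only : ∀ {k p t} → CanAttach 𝒯 (stage k) p t → k < N × p ≡ pos k × t ≡ tileAt k)
  where

  IsStage : Assembly → Set
  IsStage α = ∃ λ k → 1 ≤ k × k ≤ N × α ≗ stage k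

  attach-stage : ∀ {α k p t} → α ≗ stage k → CanAttach 𝒯 α p t → k < N × place α p t ≗ stage (suc k)
  attach-stage {α} {k} α≗ c with canAttach-only (canAttach-resp-≗ α≗ c)
  ... | k<N , refl , refl = k<N , λ q → trans (place-resp-≗ α≗ (pos k) (tileAt k) q) (place≗stage k<N q)

  grows-stage : ∀ {α β} → IsStage α → Grows 𝒯 α β → IsStage β
  grows-stage s done = s
  grows-stage (k , _ , _ , α≗) (step c g) with attach-stage α≗ c
  ... | k<N , α′≗ = grows-stage (suc k , s≤s z≤n , k<N , α′≗) g

  produced-stage : ∀ {α} → Produced 𝒯 α → IsStage α
  produced-stage = grows-stage (1 , ≤-refl , 1≤N , seed≗stage₁)

  grows-final : ∀ j {α k} → j + k ≡ N → 1 ≤ k → α ≗ stage k → ∃ λ β → Grows 𝒯 α β × β ≗ stage N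
  grows-final zero    {α} refl _   α≗ = α , done , α≗
  grows-final (suc j) {α} {k} j+k≡N 1≤k α≗
    with c ← canAttach-resp-≗ (λ q → sym (α≗ q)) (canAttach-next 1≤k (subst (k <_) j+k≡N (s≤s (m≤n+m k j))))
    with β , g , β≗ ← grows-final j (trans (+-suc j k) j+k≡N) (s≤s z≤n) (proj₂ (attach-stage α≗ c))
    = β , step c g , β≗

  final-terminal : ∀ {β} → β ≗ stage N → Terminal 𝒯 β
  final-terminal β≗ p t c = <-irrefl refl (proj₁ (attach-stage β≗ c))

  terminal-final : ∀ {β} → IsStage β → Terminal 𝒯 β → β ≗ stage N
  terminal-final (k , 1≤k , k≤N , β≗) T with k <? N
  ... | yes k<N = contradiction (canAttach-resp-≗ (λ q → sym (β≗ q)) (canAttach-next 1≤k k<N)) (T _ _)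
  ... | no  k≮N = subst (λ k → _ ≗ stage k) (≤-antisym k≤N (≮⇒≥ k≮N)) β≗

  uniquelyAssembles : ∀ {S} → (∀ β → β ≗ stage N → HasShape β S) → UniquelyAssembles 𝒯 S
  uniquelyAssembles shape α prod with k , 1≤k , k≤N , α≗ ← produced-stage prod
    with β , g , β≗ ← grows-final (N ∸ k) (m∸n+n≡m k≤N) 1≤k α≗
    = β , g , final-terminal β≗ , shape β β≗

  seq-stage : ∀ {α q} → Seq 𝒯 α q → ∃ λ k → α ≗ stage (suc k) × q ≡ pos k
  seq-stage start = 0 , seed≗stage₁ , sym pos₀
  seq-stage (attach s c) with k , α≗ , _ ← seq-stage s with canAttach-only (canAttach-resp-≗ α≗ c)
  ... | _ , refl , refl = suc k , proj₂ (attach-stage α≗ c) , refl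

  isZigZag : (∀ k → suc k < N → ZigZagMove (pos k) (pos (suc k))) → IsZigZag 𝒯
  isZigZag moves = unique , zigzag
    where
    unique : ∀ α q → Seq 𝒯 α q → ∀ p t p′ t′ → CanAttach 𝒯 α p t → CanAttach 𝒯 α p′ t′ → p ≡ p′ × t ≡ t′
    unique α q s p t p′ t′ c c′ with k , α≗ , _ ← seq-stage s
      with canAttach-only (canAttach-resp-≗ α≗ c) | canAttach-only (canAttach-resp-≗ α≗ c′)
    ... | _ , refl , refl | _ , refl , refl = refl , refl
    zigzag : ∀ α q → Seq 𝒯 α q → ∀ p t → CanAttach 𝒯 α p t → ZigZagMove q p
    zigzag α q s p t c with k , α≗ , refl ← seq-stage s with canAttach-only (canAttach-resp-≗ α≗ c)
    ... | 1+k<N , refl , refl = moves k 1+k<N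

module Snake (last : ℕ) where

  w : ℕ
  w = suc last

  -- The number of steps row y needs to reach column x.
  along : ℕ → ℕ → ℕ
  along x y = if isEven y then x else last ∸ x

  index : ℕ → ℕ → ℕ
  index x y = along x y + y * w

  cell : ℕ → Pos
  cell k = + along (k % w) (k / w) , + (k / w)

  along-even : ∀ x y → isEven y ≡ true → along x y ≡ x
  along-even x y = if-true

  along-odd : ∀ x y → isEven y ≡ false → along x y ≡ last ∸ x
  along-odd x y = if-false

  along<w : ∀ {x} y → x < w → along x y < w
  along<w {x} y x<w with isEven y
  ... | true  = x<w
  ... | false = s≤s (m∸n≤m last x)

  along-involutive : ∀ {x} y → x < w → along (along x y) y ≡ x
  along-involutive {x} y x<w with isEven y
  ... | true  = refl
  ... | false = m∸[m∸n]≡n (s≤s⁻¹ x<w)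

  along-injective : ∀ {x x′} y → x < w → x′ < w → along x y ≡ along x′ y → x ≡ x′
  along-injective y x<w x′<w eq =
    trans (sym (along-involutive y x<w)) (trans (cong (λ z → along z y) eq) (along-involutive y x′<w))

  along-vertical : ∀ {x} y → x < w → along x y ≡ last ∸ along x (suc y)
  along-vertical {x} y x<w with isEven y
  ... | true  = sym (m∸[m∸n]≡n (s≤s⁻¹ x<w))
  ... | false = refl

  along-suc-even : ∀ x y → isEven y ≡ true → along (suc x) y ≡ suc (along x y)
  along-suc-even x y e = trans (along-even (suc x) y e) (cong suc (sym (along-even x y e)))

  along-suc-odd : ∀ x y → isEven y ≡ false → suc x < w → along x y ≡ suc (along (suc x) y)
  along-suc-odd x y e 1+x<w = trans (along-odd x y e) (trans (+-∸-assoc 1 (s≤s⁻¹ 1+x<w)) (cong suc (sym (along-odd (suc x) y e))))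

  along-last-odd : ∀ y → isEven y ≡ false → along last y ≡ 0
  along-last-odd y e = trans (along-odd last y e) (n∸n≡0 last)

  index-injective : ∀ {x y x′ y′} → x < w → x′ < w → index x y ≡ index x′ y′ → x ≡ x′ × y ≡ y′
  index-injective {x} {y} {x′} {y′} x<w x′<w eq with divMod-unique y y′ (along<w y x<w) (along<w y′ x′<w) eq
  ... | eq′ , refl = along-injective y x<w x′<w eq′ , refl

  index-divMod : ∀ {x} y → x < w → index x y % w ≡ along x y × index x y / w ≡ y
  index-divMod y x<w = divMod-of y (along<w y x<w)

  cell-index : ∀ {x} y → x < w → cell (index x y) ≡ (+ x , + y)
  cell-index {x} y x<w with index-divMod y x<w
  ... | s≡ , y≡ rewrite s≡ | y≡ = cong (λ z → + z , + y) (along-involutive y x<w)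

  index-cell : ∀ k → index (along (k % w) (k / w)) (k / w) ≡ k
  index-cell k = trans (cong (_+ k / w * w) (along-involutive (k / w) (m%n<n k w))) (sym (m≡m%n+[m/n]*n k w))

  index<size : ∀ {x y h} → x < w → y < h → index x y < h * w
  index<size {x} {y} x<w y<h = ≤-trans (+-monoˡ-< (y * w) (along<w y x<w)) (*-monoˡ-≤ w y<h)

  index-vertical : ∀ {x} y x′ → x < w → index x y < index x′ (suc y)
  index-vertical y x′ x<w = ≤-trans (+-monoˡ-< (y * w) (along<w y x<w)) (m≤n+m (suc y * w) (along x′ (suc y)))

  index-suc-even : ∀ x y → isEven y ≡ true → index (suc x) y ≡ suc (index x y)
  index-suc-even x y e = cong (_+ y * w) (along-suc-even x y e)

  index-suc-odd : ∀ x y → isEven y ≡ false → suc x < w → index x y ≡ suc (index (suc x) y)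
  index-suc-odd x y e 1+x<w = cong (_+ y * w) (along-suc-odd x y e 1+x<w)

  index-row-start : ∀ {x} y → x < w → along x (suc y) ≡ 0 → index x (suc y) ≡ suc (index x y)
  index-row-start {x} y x<w s≡0 =
    trans (cong (_+ suc y * w) s≡0) (cong (λ z → suc (z + y * w)) (sym (trans (along-vertical y x<w) (cong (last ∸_) s≡0))))

  cell-divMod : ∀ {a} b → a < w → cell (a + b * w) ≡ (+ along a b , + b)
  cell-divMod b a<w rewrite proj₁ (divMod-of {w} b a<w) | proj₂ (divMod-of {w} b a<w) = refl

  index-zigzag : ∀ {x} y → x < w → ZigZagMove (+ x , + y) (cell (suc (index x y)))
  index-zigzag {x} y x<w with suc (along x y) <? w
  ... | no 1+s≮w = (λ _ → inj₂ next-row) , (λ _ → inj₂ next-row)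
    where
    s≡last : along x y ≡ last
    s≡last = ≤-antisym (s≤s⁻¹ (along<w y x<w)) (s≤s⁻¹ (≮⇒≥ 1+s≮w))
    next-row : proj₂ (cell (suc (index x y))) ≡ + y ℤ.+ ℤ.1ℤ
    next-row rewrite s≡last = trans (cong proj₂ (cell-divMod {0} (suc y) z<s)) (cong +_ (+-comm 1 y))
  ... | yes 1+s<w = subst (ZigZagMove (+ x , + y)) (sym (cell-divMod y 1+s<w)) (same-row (isEven y) refl)
    where
    same-row : ∀ b → isEven y ≡ b → ZigZagMove (+ x , + y) (+ along (suc (along x y)) y , + y)
    same-row true e =
      (λ _ → inj₁ (cong +_ (trans (along-even _ y e) (trans (cong suc (along-even x y e)) (+-comm 1 x))) , refl)) ,
      (λ ¬2∣y → contradiction (isEven⇒even y e) ¬2∣y)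
    same-row false e = (λ 2∣y → contradiction 2∣y (isOdd⇒¬even y e)) , (λ _ → inj₁ (backwards x x<w 1+s<w , refl))
      where
      backwards : ∀ x → x < w → suc (along x y) < w → + along (suc (along x y)) y ≡ + x ℤ.- ℤ.1ℤ
      backwards zero    _   1+s<w = contradiction (subst (λ s → suc s < w) (along-odd 0 y e) 1+s<w) (<-irrefl refl)
      backwards (suc x) x<w _     =
        cong +_ (trans (cong (λ s → along s y) (sym (along-suc-odd x y e x<w))) (along-involutive y (<-trans (n<1+n x) x<w)))

  cell-zigzag : ∀ k → ZigZagMove (cell k) (cell (suc k))
  cell-zigzag k = subst (λ j → ZigZagMove (cell j) (cell (suc j))) (index-cell k)
    (subst (λ p → ZigZagMove p (cell (suc (index x (k / w))))) (sym (cell-index (k / w) x<w)) (index-zigzag (k / w) x<w))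
    where
    x = along (k % w) (k / w)
    x<w = along<w (k / w) (m%n<n k w)

-- Glues 1, 2 carry a bit, 3–6 start a row, 7 marks the north-east corner; the
-- glues from 8 on are the horizontal glues of the rows, those at an even offset
-- from 8 are hard-coded (strength 2) and those at an odd offset carry the bits
-- read so far (strength 1).
glueStrength : Glue → ℕ
glueStrength 0 = 0
glueStrength 1 = 1
glueStrength 2 = 1
glueStrength 3 = 2
glueStrength 4 = 2
glueStrength 5 = 2
glueStrength 6 = 2
glueStrength 7 = 0
glueStrength (suc (suc (suc (suc (suc (suc (suc (suc k)))))))) = 2 ∸ k % 2

glueStrength-even : ∀ c → glueStrength (8 + 2 * c) ≡ 2
glueStrength-even c = cong (2 ∸_) (trans (%-congˡ (*-comm 2 c)) (m*n%n≡0 c 2))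

glueStrength-odd : ∀ c → glueStrength (9 + 2 * c) ≡ 1
glueStrength-odd c = cong (2 ∸_) (trans (%-congˡ {o = 2} (cong suc (*-comm 2 c))) ([m+kn]%n≡m%n 1 c 2))

glueStrength-bit : ∀ b → b < 2 → glueStrength (suc b) ≡ 1
glueStrength-bit 0 _ = refl
glueStrength-bit 1 _ = refl
glueStrength-bit (suc (suc _)) (s≤s (s≤s ()))

startCode : Bool → Bool → Glue
startCode false true  = 3
startCode false false = 4
startCode true  true  = 5
startCode true  false = 6

decodeStart : Glue → Bool × Bool
decodeStart 3 = false , true
decodeStart 4 = false , false
decodeStart 5 = true , true
decodeStart _ = true , false

decodeStart-startCode : ∀ t e → decodeStart (startCode t e) ≡ (t , e)
decodeStart-startCode false true  = refl
decodeStart-startCode false false = refl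
decodeStart-startCode true  true  = refl
decodeStart-startCode true  false = refl

startCode-injective : ∀ {t e t′ e′} → startCode t e ≡ startCode t′ e′ → (t , e) ≡ (t′ , e′)
startCode-injective {t} {e} {t′} {e′} eq =
  trans (sym (decodeStart-startCode t e)) (trans (cong decodeStart eq) (decodeStart-startCode t′ e′))

startCode-bounds : ∀ t e → 3 ≤ startCode t e × startCode t e < 7 × glueStrength (startCode t e) ≡ 2
startCode-bounds false true  = m≤m+n 3 0 , m≤m+n 4 3 , refl
startCode-bounds false false = m≤m+n 3 1 , m≤m+n 5 2 , refl
startCode-bounds true  true  = m≤m+n 3 2 , m≤m+n 6 1 , refl
startCode-bounds true  false = m≤m+n 3 3 , ≤-refl , refl

-- An eastward tile is entered from the west, a westward one from the east.
directed : Bool → (north south entry exit : Glue) → TileType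
directed true  nᵍ sᵍ i o = tile nᵍ o sᵍ i
directed false nᵍ sᵍ i o = tile nᵍ i sᵍ o

entrySide : Bool → TileType → Glue
entrySide true  = west
entrySide false = east

module _ {nᵍ sᵍ i o : Glue} where
  north-directed : ∀ b → north (directed b nᵍ sᵍ i o) ≡ nᵍ
  north-directed true  = refl
  north-directed false = refl

  south-directed : ∀ b → south (directed b nᵍ sᵍ i o) ≡ sᵍ
  south-directed true  = refl
  south-directed false = refl

  entrySide-directed : ∀ b → entrySide b (directed b nᵍ sᵍ i o) ≡ i
  entrySide-directed true  = refl
  entrySide-directed false = refl

  entrySide-directed-not : ∀ b → entrySide (not b) (directed b nᵍ sᵍ i o) ≡ o
  entrySide-directed-not true  = refl
  entrySide-directed-not false = refl

  east-directed : ∀ b → east (directed b nᵍ sᵍ i o) ≡ (if b then o else i)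
  east-directed true  = refl
  east-directed false = refl

  west-directed : ∀ b → west (directed b nᵍ sᵍ i o) ≡ (if b then i else o)
  west-directed true  = refl
  west-directed false = refl

directed-cong : ∀ {b nᵍ sᵍ i o b′ nᵍ′ sᵍ′ i′ o′} → b ≡ b′ → nᵍ ≡ nᵍ′ → sᵍ ≡ sᵍ′ → i ≡ i′ → o ≡ o′ →
                directed b nᵍ sᵍ i o ≡ directed b′ nᵍ′ sᵍ′ i′ o′
directed-cong refl refl refl refl refl = refl

module Rectangle (m l : ℕ) (n<2^L : suc m < 2 ^ suc l) where

  n L last : ℕ
  n    = suc m
  L    = suc l
  last = suc (L + L)

  open Snake last public

  isTop : ℕ → Bool
  isTop y = does (y ≟ m)

  isBottom : ℕ → Bool
  isBottom zero    = true
  isBottom (suc _) = false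

  isMiddle : ℕ → Bool
  isMiddle y = not (isBottom y) ∧ not (isTop y)

  reads : ℕ → ℕ → Bool
  reads y s = isMiddle y ∧ does (s <? L)

  rowParity : ℕ → ℕ
  rowParity y = if isEven y then 0 else 1

  startGlue : ℕ → Glue
  startGlue y = startCode (isTop y) (isEven y)

  eastEdge : ℕ → Glue
  eastEdge y = if isTop y then 7 else 0

  fixedGlue : ℕ → ℕ → Glue
  fixedGlue y s = 8 + 2 * (s + y * w)

  readGlue : ℕ → ℕ → ℕ → Glue
  readGlue p s v = 9 + 2 * (s + (p + v * 2) * w)

  -- The glue between steps s and s + 1 of row y.
  link : ℕ → ℕ → Glue
  link y s = if reads y s then readGlue (rowParity y) s (lowBits y s) else fixedGlue y s

  entryGlue : ℕ → ℕ → Glue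
  entryGlue y zero    = if isEven y then 0 else eastEdge y
  entryGlue y (suc s) = link y s

  exitGlue : ℕ → ℕ → Glue
  exitGlue y s = if does (s ≟ last) then (if isEven y then eastEdge y else 0) else link y s

  -- Step s > L writes bit 2L − s of y + 1; it lies below step 2L + 1 − s of
  -- row y + 1, which reads exactly that bit.
  northGlue : ℕ → ℕ → Glue
  northGlue y s =
    if isTop y then 0
    else if does (s ≟ last) then startGlue (suc y)
    else if does (L <? s) then suc (bit (suc y) ((L + L) ∸ s))
    else 0

  southGlue : ℕ → ℕ → Glue
  southGlue y zero    = if isBottom y then 0 else startGlue y
  southGlue y (suc s) = if reads y s then suc (bit y s) else 0

  rowTile : ℕ → ℕ → TileType
  rowTile y s = directed (isEven y) (northGlue y s) (southGlue y s) (entryGlue y s) (exitGlue y s)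

  L<last : L < last
  L<last = s≤s (m≤m+n L L)

  does-last : does (last ≟ last) ≡ true
  does-last = dec-true (last ≟ last) refl

  does-≢last : ∀ {s} → s ≢ last → does (s ≟ last) ≡ false
  does-≢last {s} = dec-false (s ≟ last)

  isTop-m : isTop m ≡ true
  isTop-m = dec-true (m ≟ m) refl

  isTop⇒≡m : ∀ y → isTop y ≡ true → y ≡ m
  isTop⇒≡m y = does-true (y ≟ m)

  isTop-<m : ∀ {y} → y < m → isTop y ≡ false
  isTop-<m {y} y<m = dec-false (y ≟ m) (<⇒≢ y<m)

  reads-inv : ∀ y s → reads y s ≡ true → isBottom y ≡ false × isTop y ≡ false × s < L
  reads-inv y s e with isBottom y | isTop y
  ... | false | false = refl , refl , does-true (s <? L) e
  reads-inv y s () | false | true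
  reads-inv y s () | true  | _

  reads-intro : ∀ {y s} → isBottom y ≡ false → isTop y ≡ false → s < L → reads y s ≡ true
  reads-intro {y} {s} b t s<L rewrite b | t = dec-true (s <? L) s<L

  rowParity<2 : ∀ y → rowParity y < 2
  rowParity<2 y with isEven y
  ... | true  = s≤s z≤n
  ... | false = s≤s (s≤s z≤n)

  rowParity-injective : ∀ y y′ → rowParity y ≡ rowParity y′ → isEven y ≡ isEven y′
  rowParity-injective y y′ e with isEven y | isEven y′
  ... | true  | true  = refl
  ... | false | false = refl
  rowParity-injective y y′ () | true  | false
  rowParity-injective y y′ () | false | true

  north-rowTile : ∀ y s → north (rowTile y s) ≡ northGlue y s
  north-rowTile y s = north-directed (isEven y)

  south-rowTile : ∀ y s → south (rowTile y s) ≡ southGlue y s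
  south-rowTile y s = south-directed (isEven y)

  east-rowTile : ∀ y s → east (rowTile y s) ≡ (if isEven y then exitGlue y s else entryGlue y s)
  east-rowTile y s = east-directed (isEven y)

  west-rowTile : ∀ y s → west (rowTile y s) ≡ (if isEven y then entryGlue y s else exitGlue y s)
  west-rowTile y s = west-directed (isEven y)

  entry-rowTile : ∀ y y′ s′ → isEven y′ ≡ isEven y → entrySide (isEven y) (rowTile y′ s′) ≡ entryGlue y′ s′
  entry-rowTile y y′ s′ e rewrite sym e = entrySide-directed (isEven y′)

  entry-rowTile-opposite : ∀ y y′ s′ → isEven y′ ≢ isEven y → entrySide (isEven y) (rowTile y′ s′) ≡ exitGlue y′ s′
  entry-rowTile-opposite y y′ s′ e rewrite ¬-not (λ e′ → e (sym e′)) = entrySide-directed-not (isEven y′)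

  fixedGlue-strength : ∀ y s → glueStrength (fixedGlue y s) ≡ 2
  fixedGlue-strength y s = glueStrength-even (s + y * w)

  readGlue-strength : ∀ p s v → glueStrength (readGlue p s v) ≡ 1
  readGlue-strength p s v = glueStrength-odd (s + (p + v * 2) * w)

  fixedGlue-injective : ∀ {y s y′ s′} → s < w → s′ < w → fixedGlue y s ≡ fixedGlue y′ s′ → y ≡ y′ × s ≡ s′
  fixedGlue-injective {y} {y′ = y′} s<w s′<w e
    with s≡s′ , y≡y′ ← divMod-unique y y′ s<w s′<w (*-cancelˡ-≡ _ _ 2 (+-cancelˡ-≡ 8 _ _ e)) = y≡y′ , s≡s′

  readGlue-injective : ∀ {p s v p′ s′ v′} → s < w → s′ < w → p < 2 → p′ < 2 →
                       readGlue p s v ≡ readGlue p′ s′ v′ → p ≡ p′ × s ≡ s′ × v ≡ v′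
  readGlue-injective {p} {s} {v} {p′} {s′} {v′} s<w s′<w p<2 p′<2 e
    with s≡s′ , pv≡ ← divMod-unique (p + v * 2) (p′ + v′ * 2) s<w s′<w (*-cancelˡ-≡ _ _ 2 (+-cancelˡ-≡ 9 _ _ e))
    with p≡p′ , v≡v′ ← divMod-unique v v′ p<2 p′<2 pv≡ = p≡p′ , s≡s′ , v≡v′

  fixedGlue≢readGlue : ∀ y s p s′ v → fixedGlue y s ≢ readGlue p s′ v
  fixedGlue≢readGlue y s p s′ v e = even≢odd (s + y * w) (s′ + (p + v * 2) * w) (+-cancelˡ-≡ 8 _ _ e)

  fixedGlue≢small : ∀ y s {g} → g < 8 → fixedGlue y s ≢ g
  fixedGlue≢small y s g<8 e = <⇒≱ g<8 (subst (8 ≤_) e (m≤m+n 8 _))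

  readGlue≢small : ∀ p s v {g} → g < 8 → readGlue p s v ≢ g
  readGlue≢small p s v g<8 e = <⇒≱ g<8 (subst (8 ≤_) e (m≤m+n 8 (suc (2 * (s + (p + v * 2) * w)))))

  link-cases : ∀ y s → (reads y s ≡ true × link y s ≡ readGlue (rowParity y) s (lowBits y s))
                     ⊎ (reads y s ≡ false × link y s ≡ fixedGlue y s)
  link-cases y s with reads y s
  ... | true  = inj₁ (refl , refl)
  ... | false = inj₂ (refl , refl)

  link≢small : ∀ y s {g} → g < 8 → link y s ≢ g
  link≢small y s g<8 with link-cases y s
  ... | inj₁ (_ , e) = λ e′ → readGlue≢small (rowParity y) s (lowBits y s) g<8 (trans (sym e) e′)
  ... | inj₂ (_ , e) = λ e′ → fixedGlue≢small y s g<8 (trans (sym e) e′)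

  startGlue-injective : ∀ y y′ → startGlue y ≡ startGlue y′ → isTop y ≡ isTop y′ × isEven y ≡ isEven y′
  startGlue-injective y y′ e = cong proj₁ te , cong proj₂ te
    where te = startCode-injective {isTop y} {isEven y} {isTop y′} {isEven y′} e

  3≤startGlue : ∀ y → 3 ≤ startGlue y
  3≤startGlue y = proj₁ (startCode-bounds (isTop y) (isEven y))

  startGlue<7 : ∀ y → startGlue y < 7
  startGlue<7 y = proj₁ (proj₂ (startCode-bounds (isTop y) (isEven y)))

  startGlue-strength : ∀ y → glueStrength (startGlue y) ≡ 2
  startGlue-strength y = proj₂ (proj₂ (startCode-bounds (isTop y) (isEven y)))

  bit<2 : ∀ y i → bit y i < 2
  bit<2 y i = m%n<n (shiftR y i) 2

  bitGlue-strength : ∀ y i → glueStrength (suc (bit y i)) ≡ 1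
  bitGlue-strength y i = glueStrength-bit (bit y i) (bit<2 y i)

  eastEdge<8 : ∀ y → eastEdge y < 8
  eastEdge<8 y with isTop y
  ... | true  = ≤-refl
  ... | false = z<s

  eastEdge-strength : ∀ y → glueStrength (eastEdge y) ≡ 0
  eastEdge-strength y with isTop y
  ... | true  = refl
  ... | false = refl

  eastEdge≡7⇒isTop : ∀ y → eastEdge y ≡ 7 → isTop y ≡ true
  eastEdge≡7⇒isTop y e with isTop y
  eastEdge≡7⇒isTop y e  | true  = refl
  eastEdge≡7⇒isTop y () | false

  northGlue-top : ∀ y s → isTop y ≡ true → northGlue y s ≡ 0
  northGlue-top y s = if-true

  northGlue-last : ∀ y → isTop y ≡ false → northGlue y last ≡ startGlue (suc y)
  northGlue-last y t = trans (if-false t) (if-true does-last)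

  northGlue-write : ∀ y s → isTop y ≡ false → s ≢ last → L < s → northGlue y s ≡ suc (bit (suc y) ((L + L) ∸ s))
  northGlue-write y s t s≢last L<s = trans (if-false t) (trans (if-false (does-≢last s≢last)) (if-true (dec-true (L <? s) L<s)))

  northGlue-blank : ∀ y s → isTop y ≡ false → s ≢ last → s ≤ L → northGlue y s ≡ 0
  northGlue-blank y s t s≢last s≤L = trans (if-false t) (trans (if-false (does-≢last s≢last)) (if-false (dec-false (L <? s) (≤⇒≯ s≤L))))

  northGlue-cases : ∀ y s → northGlue y s ≡ 0
                          ⊎ (isTop y ≡ false × s ≡ last × northGlue y s ≡ startGlue (suc y))
                          ⊎ ∃ λ i → northGlue y s ≡ suc (bit (suc y) i)
  northGlue-cases y s = bool-cases (isTop y) (λ t → inj₁ (northGlue-top y s t)) λ t → case s ≟ last of λ where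
    (yes s≡last) → inj₂ (inj₁ (t , s≡last , trans (cong (northGlue y) s≡last) (northGlue-last y t)))
    (no s≢last)  → case L <? s of λ where
      (yes L<s) → inj₂ (inj₂ ((L + L) ∸ s , northGlue-write y s t s≢last L<s))
      (no L≮s)  → inj₁ (northGlue-blank y s t s≢last (≮⇒≥ L≮s))

  northGlue-strong : ∀ y s → 2 ≤ glueStrength (northGlue y s) → isTop y ≡ false × s ≡ last
  northGlue-strong y s 2≤ with northGlue-cases y s
  ... | inj₁ e                    = contradiction (subst (λ g → 2 ≤ glueStrength g) e 2≤) λ ()
  ... | inj₂ (inj₁ (t , s≡ , _))  = t , s≡
  ... | inj₂ (inj₂ (i , e))       =
    contradiction (subst (λ g → 2 ≤ glueStrength g) e 2≤) (subst (2 ≰_) (sym (bitGlue-strength (suc y) i)) λ { (s≤s ()) })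

  northGlue<7 : ∀ y s → northGlue y s < 7
  northGlue<7 y s with northGlue-cases y s
  ... | inj₁ e                    = subst (_< 7) (sym e) z<s
  ... | inj₂ (inj₁ (_ , _ , e))   = subst (_< 7) (sym e) (startGlue<7 (suc y))
  ... | inj₂ (inj₂ (i , e))       = subst (_< 7) (sym e) (≤-trans (s≤s (bit<2 (suc y) i)) (m≤m+n 3 4))

  southGlue-bottom : ∀ s → southGlue 0 s ≡ 0
  southGlue-bottom zero    = refl
  southGlue-bottom (suc s) = refl

  southGlue-start : ∀ y → isBottom y ≡ false → southGlue y 0 ≡ startGlue y
  southGlue-start y = if-false

  southGlue-read : ∀ y s → reads y s ≡ true → southGlue y (suc s) ≡ suc (bit y s)
  southGlue-read y s = if-true

  southGlue-cases : ∀ y s → southGlue y s ≡ 0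
                          ⊎ (s ≡ 0 × isBottom y ≡ false × southGlue y s ≡ startGlue y)
                          ⊎ ∃ λ i → southGlue y s ≡ suc (bit y i)
  southGlue-cases y zero    = bool-cases (isBottom y) (λ b → inj₁ (if-true b)) (λ b → inj₂ (inj₁ (refl , b , if-false b)))
  southGlue-cases y (suc s) = bool-cases (reads y s) (λ r → inj₂ (inj₂ (s , if-true r))) (λ r → inj₁ (if-false r))

  southGlue<7 : ∀ y s → southGlue y s < 7
  southGlue<7 y s with southGlue-cases y s
  ... | inj₁ e                  = subst (_< 7) (sym e) z<s
  ... | inj₂ (inj₁ (_ , _ , e)) = subst (_< 7) (sym e) (startGlue<7 y)
  ... | inj₂ (inj₂ (i , e))     = subst (_< 7) (sym e) (≤-trans (s≤s (bit<2 y i)) (m≤m+n 3 4))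

  southGlue≡startGlue : ∀ y′ s′ y → southGlue y′ s′ ≡ startGlue y →
                        s′ ≡ 0 × isBottom y′ ≡ false × startGlue y′ ≡ startGlue y
  southGlue≡startGlue y′ s′ y e with southGlue-cases y′ s′
  ... | inj₁ e′                  = contradiction (subst (3 ≤_) (trans (sym e) e′) (3≤startGlue y)) λ ()
  ... | inj₂ (inj₁ (s≡ , b , e′)) = s≡ , b , trans (sym e′) e
  ... | inj₂ (inj₂ (i , e′))     = contradiction (subst (3 ≤_) (trans (sym e) e′) (3≤startGlue y)) (<⇒≱ (s≤s (bit<2 y′ i)))

  entryGlue-first<8 : ∀ y → entryGlue y 0 < 8
  entryGlue-first<8 y with isEven y
  ... | true  = z<s
  ... | false = eastEdge<8 y

  exitGlue-last : ∀ y → exitGlue y last ≡ (if isEven y then eastEdge y else 0)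
  exitGlue-last y = if-true does-last

  exitGlue-last<8 : ∀ y → exitGlue y last < 8
  exitGlue-last<8 y rewrite exitGlue-last y with isEven y
  ... | true  = eastEdge<8 y
  ... | false = z<s

  exitGlue-link : ∀ y s → s ≢ last → exitGlue y s ≡ link y s
  exitGlue-link y s s≢last = if-false (does-≢last s≢last)

  tileOfIndex : ℕ → TileType
  tileOfIndex j = rowTile (j / w) (j % w)

  tileTypes : List TileType
  tileTypes = map tileOfIndex (upTo (n * w))

  𝒯 : TileSystem
  𝒯 = record
    { tiles    = tileTypes
    ; seed     = rowTile 0 0
    ; seed∈T   = ∈-map⁺ tileOfIndex (∈-upTo⁺ z<s)
    ; τ        = 2
    ; str      = glueStrength
    ; str-null = refl
    }

  tileTypes-inv : ∀ {t} → t ∈ tileTypes → ∃ λ y → ∃ λ s → y < n × s < w × t ≡ rowTile y s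
  tileTypes-inv t∈ with j , j∈ , refl ← ∈-map⁻ tileOfIndex t∈ =
    j / w , j % w , m<n*o⇒m/o<n (∈-upTo⁻ j∈) , m%n<n j w , refl

  rowTile∈tileTypes : ∀ {y s} → y < n → s < w → rowTile y s ∈ tileTypes
  rowTile∈tileTypes {y} {s} y<n s<w with divMod-of {w} y s<w
  ... | s≡ , y≡ = subst (_∈ tileTypes) (cong₂ rowTile y≡ s≡)
                    (∈-map⁺ tileOfIndex (∈-upTo⁺ (≤-trans (+-monoˡ-< (y * w) s<w) (*-monoˡ-≤ w y<n))))

  belowGlue : ℕ → ℕ → Maybe Glue
  belowGlue zero    s = nothing
  belowGlue (suc y) s = just (northGlue y (last ∸ s))

  previousGlue : ℕ → ℕ → Maybe Glue
  previousGlue y zero    = nothing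
  previousGlue y (suc s) = just (exitGlue y s)

  -- The strength with which t binds at step s of row y once exactly the cells
  -- before that step are filled.
  support : ℕ → ℕ → TileType → ℕ
  support y s t = bond 𝒯 (south t) (belowGlue y s) + bond 𝒯 (entrySide (isEven y) t) (previousGlue y s)

  last∸suc≢last : ∀ s → last ∸ suc s ≢ last
  last∸suc≢last s = <⇒≢ (s≤s (m∸n≤m (L + L) s))

  northGlue-read : ∀ {y} s → y < m → s < L → northGlue y (last ∸ suc s) ≡ suc (bit (suc y) s)
  northGlue-read {y} s y<m s<L =
    trans (northGlue-write y ((L + L) ∸ s) (isTop-<m y<m) (last∸suc≢last s) L<[L+L]∸s)
          (cong (λ i → suc (bit (suc y) i)) (m∸[m∸n]≡n (≤-trans (<⇒≤ s<L) (m≤m+n L L))))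
    where
    L<[L+L]∸s : L < (L + L) ∸ s
    L<[L+L]∸s = subst (L <_) (sym (+-∸-assoc L (<⇒≤ s<L)))
                  (subst (_< L + (L ∸ s)) (+-identityʳ L) (+-monoʳ-< L (m<n⇒0<n∸m s<L)))

  belowBond≤1 : ∀ y s t → bond 𝒯 (south t) (belowGlue y (suc s)) ≤ 1
  belowBond≤1 zero    s t = z≤n
  belowBond≤1 (suc y) s t with 2 ≤? glueStrength (northGlue y (last ∸ suc s))
  ... | yes 2≤ = contradiction (proj₂ (northGlue-strong y _ 2≤)) (last∸suc≢last s)
  ... | no  2≰ = ≤-trans (bond≤str 𝒯 (south t) _) (s≤s⁻¹ (≰⇒> 2≰))

  lowBits-injective : ∀ {y y′} → y < n → y′ < n → lowBits y L ≡ lowBits y′ L → y ≡ y′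
  lowBits-injective y<n y′<n e =
    trans (sym (lowBits-complete L (<-trans y<n n<2^L))) (trans e (lowBits-complete L (<-trans y′<n n<2^L)))

  entry-link : ∀ y y′ s′ {g} → 8 ≤ g → entrySide (isEven y) (rowTile y′ s′) ≡ g →
               (isEven y′ ≡ isEven y × ∃ λ s₁ → s′ ≡ suc s₁ × link y′ s₁ ≡ g)
             ⊎ (isEven y′ ≢ isEven y × link y′ s′ ≡ g)
  entry-link y y′ s′ {g} 8≤g e with isEven y′ Bool.≟ isEven y
  ... | yes same = inj₁ (same , from-entry s′ (trans (sym (entry-rowTile y y′ s′ same)) e))
    where
    from-entry : ∀ s′ → entryGlue y′ s′ ≡ g → ∃ λ s₁ → s′ ≡ suc s₁ × link y′ s₁ ≡ g
    from-entry zero     e′ = contradiction (subst (_< 8) e′ (entryGlue-first<8 y′)) (≤⇒≯ 8≤g)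
    from-entry (suc s₁) e′ = s₁ , refl , e′
  ... | no opp with s′ ≟ last
  ...   | yes refl   = contradiction (subst (_< 8) (trans (sym (entry-rowTile-opposite y y′ last opp)) e) (exitGlue-last<8 y′)) (≤⇒≯ 8≤g)
  ...   | no s′≢last = inj₂ (opp , trans (sym (exitGlue-link y′ s′ s′≢last)) (trans (sym (entry-rowTile-opposite y y′ s′ opp)) e))

  link≡fixedGlue : ∀ y′ s₁ y s → s₁ < w → s < w → link y′ s₁ ≡ fixedGlue y s → y′ ≡ y × s₁ ≡ s
  link≡fixedGlue y′ s₁ y s s₁<w s<w e with link-cases y′ s₁
  ... | inj₁ (_ , e′) = contradiction (trans (sym e) e′) (fixedGlue≢readGlue y s (rowParity y′) s₁ (lowBits y′ s₁))
  ... | inj₂ (_ , e′) = fixedGlue-injective s₁<w s<w (trans (sym e′) e)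

  link≡readGlue : ∀ y′ s₁ p s v → s₁ < w → s < w → p < 2 → link y′ s₁ ≡ readGlue p s v →
                  reads y′ s₁ ≡ true × rowParity y′ ≡ p × s₁ ≡ s × lowBits y′ s₁ ≡ v
  link≡readGlue y′ s₁ p s v s₁<w s<w p<2 e with link-cases y′ s₁
  ... | inj₂ (_ , e′) = contradiction (trans (sym e′) e) (fixedGlue≢readGlue y′ s₁ p s v)
  ... | inj₁ (r , e′) with p≡ , s≡ , v≡ ← readGlue-injective s₁<w s<w (rowParity<2 y′) p<2 (trans (sym e′) e) = r , p≡ , s≡ , v≡

  rowTile-start : ∀ y′ y → isBottom y′ ≡ false → isBottom y ≡ false → isTop y′ ≡ isTop y → isEven y′ ≡ isEven y →
                  rowTile y′ 0 ≡ rowTile y 0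
  rowTile-start y′ y b′ b t e = bool-cases (isTop y) top below-top
    where
    top : isTop y ≡ true → rowTile y′ 0 ≡ rowTile y 0
    top t₁ = cong (λ y → rowTile y 0) (trans (isTop⇒≡m y′ (trans t t₁)) (sym (isTop⇒≡m y t₁)))
    below-top : isTop y ≡ false → rowTile y′ 0 ≡ rowTile y 0
    below-top t₀ = directed-cong e
      (trans (northGlue-blank y′ 0 (trans t t₀) (λ ()) z≤n) (sym (northGlue-blank y 0 t₀ (λ ()) z≤n)))
      (trans (southGlue-start y′ b′) (trans (cong₂ startCode t e) (sym (southGlue-start y b))))
      (cong₂ (λ e t → if e then 0 else (if t then 7 else 0)) e t)
      (trans (exitGlue-link y′ 0 (λ ())) (trans (if-true (reads-intro b′ (trans t t₀) z<s))
        (trans (cong (λ e → readGlue (if e then 0 else 1) 0 0) e)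
               (sym (trans (exitGlue-link y 0 (λ ())) (if-true (reads-intro b t₀ z<s)))))))

  rowTile-read : ∀ {y′ y s} → y′ < n → y < n → isEven y′ ≡ isEven y → reads y′ s ≡ true → reads y s ≡ true →
                 lowBits y′ s ≡ lowBits y s → bit y′ s ≡ bit y s → rowTile y′ (suc s) ≡ rowTile y (suc s)
  rowTile-read {y′} {y} {s} y′<n y<n e r′ r low≡ bit≡ = by-position (suc s ≟ L)
    where
    b′ = proj₁ (reads-inv y′ s r′)
    t′ = proj₁ (proj₂ (reads-inv y′ s r′))
    b  = proj₁ (reads-inv y s r)
    t  = proj₁ (proj₂ (reads-inv y s r))
    s<L = proj₂ (proj₂ (reads-inv y s r))
    p≡ = cong (λ e → if e then 0 else 1) e
    low′≡ : lowBits y′ (suc s) ≡ lowBits y (suc s)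
    low′≡ = cong₂ (λ v b → v + b * 2 ^ s) low≡ bit≡
    by-position : Dec (suc s ≡ L) → rowTile y′ (suc s) ≡ rowTile y (suc s)
    -- After the last reading step the bits read so far are all of y′ and y.
    by-position (yes 1+s≡L) =
      cong (λ y → rowTile y (suc s)) (lowBits-injective y′<n y<n (subst (λ i → lowBits y′ i ≡ lowBits y i) 1+s≡L low′≡))
    by-position (no 1+s≢L) = directed-cong e
      (trans (northGlue-blank y′ (suc s) t′ 1+s≢last s<L) (sym (northGlue-blank y (suc s) t 1+s≢last s<L)))
      (trans (southGlue-read y′ s r′) (trans (cong suc bit≡) (sym (southGlue-read y s r))))
      (trans (if-true r′) (trans (cong₂ (λ p v → readGlue p s v) p≡ low≡) (sym (if-true r))))
      (trans (exitGlue-link y′ (suc s) 1+s≢last) (trans (if-true (reads-intro b′ t′ 1+s<L))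
        (trans (cong₂ (λ p v → readGlue p (suc s) v) p≡ low′≡)
               (sym (trans (exitGlue-link y (suc s) 1+s≢last) (if-true (reads-intro b t 1+s<L)))))))
      where
      1+s<L = ≤∧≢⇒< s<L 1+s≢L
      1+s≢last : suc s ≢ last
      1+s≢last = <⇒≢ (<-trans 1+s<L L<last)

  start-determined : ∀ {y t} → t ∈ tileTypes → 2 ≤ support (suc y) 0 t → t ≡ rowTile (suc y) 0
  start-determined {y} t∈ 2≤ with y′ , s′ , _ , _ , refl ← tileTypes-inv t∈ = begin
    rowTile y′ s′     ≡⟨ cong (rowTile y′) s′≡0 ⟩
    rowTile y′ 0      ≡⟨ rowTile-start y′ (suc y) b′ refl (proj₁ same) (proj₂ same) ⟩
    rowTile (suc y) 0 ∎
    where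
    open ≡-Reasoning
    2≤bond = subst (2 ≤_) (+-identityʳ _) 2≤
    not-top = proj₁ (northGlue-strong y last (≤-trans 2≤bond (bond≤str 𝒯 (south (rowTile y′ s′)) _)))
    south≡ : southGlue y′ s′ ≡ startGlue (suc y)
    south≡ = trans (sym (south-rowTile y′ s′))
               (trans (bond-match 𝒯 _ _ (≤-trans (s≤s z≤n) 2≤bond)) (northGlue-last y not-top))
    s′≡0 = proj₁ (southGlue≡startGlue y′ s′ (suc y) south≡)
    b′ = proj₁ (proj₂ (southGlue≡startGlue y′ s′ (suc y) south≡))
    same = startGlue-injective y′ (suc y) (proj₂ (proj₂ (southGlue≡startGlue y′ s′ (suc y) south≡)))

  fixed-determined : ∀ {y s t} → s < last → t ∈ tileTypes → link y s ≡ fixedGlue y s →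
                     2 ≤ support y (suc s) t → t ≡ rowTile y (suc s)
  fixed-determined {y} {s} s<last t∈ fixed 2≤ with y′ , s′ , _ , s′<w , refl ← tileTypes-inv t∈
    with entry-link y y′ s′ (m≤m+n 8 _) entry≡
    where
    entry≡ : entrySide (isEven y) (rowTile y′ s′) ≡ fixedGlue y s
    entry≡ = trans (bond-match 𝒯 _ _ (1≤right (belowBond≤1 y s (rowTile y′ s′)) 2≤)) (trans (exitGlue-link y s (<⇒≢ s<last)) fixed)
  ... | inj₁ (_ , s₁ , refl , e)
    with refl , refl ← link≡fixedGlue y′ s₁ y s (<-trans (n<1+n s₁) s′<w) (<-trans s<last (n<1+n last)) e = refl
  ... | inj₂ (opp , e) = contradiction (cong isEven (proj₁ (link≡fixedGlue y′ s′ y s s′<w (<-trans s<last (n<1+n last)) e))) opp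

  read-determined : ∀ {y s t} → suc y < n → t ∈ tileTypes → reads (suc y) s ≡ true →
                    link (suc y) s ≡ readGlue (rowParity (suc y)) s (lowBits (suc y) s) →
                    2 ≤ support (suc y) (suc s) t → t ≡ rowTile (suc y) (suc s)
  read-determined {y} {s} 1+y<n t∈ r read 2≤ with y′ , s′ , y′<n , s′<w , refl ← tileTypes-inv t∈ =
    [ (λ (same , s₁ , s′≡ , e) → same-direction same s₁ s′≡ e)
    , (λ (opp , e) → contradiction (rowParity-injective y′ (suc y) (proj₁ (proj₂ (link≡read s′ s′<w e)))) opp)
    ]′ (entry-link (suc y) y′ s′ (m≤m+n 8 _) entry≡)
    where
    here = readGlue (rowParity (suc y)) s (lowBits (suc y) s)
    s<L = proj₂ (proj₂ (reads-inv (suc y) s r))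
    s<last = <-trans s<L L<last
    link≡read : ∀ s₁ → s₁ < w → link y′ s₁ ≡ here →
                reads y′ s₁ ≡ true × rowParity y′ ≡ rowParity (suc y) × s₁ ≡ s × lowBits y′ s₁ ≡ lowBits (suc y) s
    link≡read s₁ s₁<w = link≡readGlue y′ s₁ _ s _ s₁<w (<-trans s<last (n<1+n last)) (rowParity<2 (suc y))
    exit≡ : exitGlue (suc y) s ≡ here
    exit≡ = trans (exitGlue-link (suc y) s (<⇒≢ s<last)) read
    entry-weak : bond 𝒯 (entrySide (isEven (suc y)) (rowTile y′ s′)) (just (exitGlue (suc y) s)) ≤ 1
    entry-weak = ≤-trans (bond≤str 𝒯 (entrySide (isEven (suc y)) (rowTile y′ s′)) (exitGlue (suc y) s))
                         (≤-reflexive (trans (cong glueStrength exit≡) (readGlue-strength (rowParity (suc y)) s (lowBits (suc y) s))))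
    both = 1≤both (belowBond≤1 (suc y) s (rowTile y′ s′)) entry-weak 2≤
    entry≡ : entrySide (isEven (suc y)) (rowTile y′ s′) ≡ here
    entry≡ = trans (bond-match 𝒯 (entrySide (isEven (suc y)) (rowTile y′ s′)) (exitGlue (suc y) s) (proj₂ both)) exit≡
    south≡ : south (rowTile y′ s′) ≡ suc (bit (suc y) s)
    south≡ = trans (bond-match 𝒯 (south (rowTile y′ s′)) (northGlue y (last ∸ suc s)) (proj₁ both))
                   (northGlue-read s (s≤s⁻¹ 1+y<n) s<L)
    same-direction : isEven y′ ≡ isEven (suc y) → ∀ s₁ → s′ ≡ suc s₁ → link y′ s₁ ≡ here → rowTile y′ s′ ≡ rowTile (suc y) (suc s)
    same-direction same s₁ s′≡ e with r′ , _ , refl , low≡ ← link≡read s₁ (<-trans (n<1+n s₁) (subst (_< w) s′≡ s′<w)) e =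
      trans (cong (rowTile y′) s′≡) (rowTile-read {y′} {suc y} {s} y′<n 1+y<n same r′ r low≡ (suc-injective (begin
        suc (bit y′ s)               ≡⟨ southGlue-read y′ s r′ ⟨
        southGlue y′ (suc s)         ≡⟨ south-rowTile y′ (suc s) ⟨
        south (rowTile y′ (suc s))   ≡⟨ cong (λ s′ → south (rowTile y′ s′)) s′≡ ⟨
        south (rowTile y′ s′)        ≡⟨ south≡ ⟩
        suc (bit (suc y) s)          ∎)))
      where open ≡-Reasoning

  support-determines : ∀ {y s t} → y < n → s < w → t ∈ tileTypes → 2 ≤ support y s t → t ≡ rowTile y s
  support-determines {zero}  {zero}  _ _ _ ()
  support-determines {suc y} {zero}  _ _ t∈ 2≤ = start-determined t∈ 2≤
  support-determines {y}     {suc s} y<n 1+s<w t∈ 2≤ with link-cases y s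
  ... | inj₂ (_ , fixed) = fixed-determined (s≤s⁻¹ 1+s<w) t∈ fixed 2≤
  support-determines {suc y} {suc s} y<n _ t∈ 2≤ | inj₁ (r , read) = read-determined {y} {s} y<n t∈ r read 2≤

  entryBond-rowTile : ∀ y s → s < last → bond 𝒯 (entrySide (isEven y) (rowTile y (suc s))) (previousGlue y (suc s)) ≡ glueStrength (link y s)
  entryBond-rowTile y s s<last =
    trans (cong₂ (λ g h → bond 𝒯 g (just h)) (entry-rowTile y y (suc s) refl) (exitGlue-link y s (<⇒≢ s<last)))
          (bond-self 𝒯 (link y s))

  support-rowTile : ∀ {y s} → y < n → s < w → 1 ≤ s + y * w → 2 ≤ support y s (rowTile y s)
  support-rowTile {zero}  {zero}  _ _ ()
  support-rowTile {suc y} {zero}  1+y<n _ _ = ≤-reflexive (sym (begin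
    bond 𝒯 (south (rowTile (suc y) 0)) (just (northGlue y last)) + 0
      ≡⟨ +-identityʳ _ ⟩
    bond 𝒯 (south (rowTile (suc y) 0)) (just (northGlue y last))
      ≡⟨ cong₂ (λ g h → bond 𝒯 g (just h)) (south-rowTile (suc y) 0) (northGlue-last y (isTop-<m (s≤s⁻¹ 1+y<n))) ⟩
    bond 𝒯 (startGlue (suc y)) (just (startGlue (suc y)))
      ≡⟨ trans (bond-self 𝒯 (startGlue (suc y))) (startGlue-strength (suc y)) ⟩
    2 ∎))
    where open ≡-Reasoning
  support-rowTile {y} {suc s} y<n 1+s<w _ with link-cases y s
  ... | inj₂ (_ , fixed) = subst (2 ≤_) (sym (cong (_+_ (bond 𝒯 (south (rowTile y (suc s))) (belowGlue y (suc s))))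
                             (trans (entryBond-rowTile y s (s≤s⁻¹ 1+s<w)) (trans (cong glueStrength fixed) (fixedGlue-strength y s)))))
                             (m≤n+m 2 _)
  support-rowTile {suc y} {suc s} 1+y<n 1+s<w _ | inj₁ (r , read) = ≤-reflexive (sym (cong₂ _+_ below entry))
    where
    below : bond 𝒯 (south (rowTile (suc y) (suc s))) (just (northGlue y (last ∸ suc s))) ≡ 1
    below = trans (cong₂ (λ g h → bond 𝒯 g (just h)) (trans (south-rowTile (suc y) (suc s)) (southGlue-read (suc y) s r))
                    (northGlue-read s (s≤s⁻¹ 1+y<n) (proj₂ (proj₂ (reads-inv (suc y) s r)))))
                  (trans (bond-self 𝒯 (suc (bit (suc y) s))) (bitGlue-strength (suc y) s))
    entry : bond 𝒯 (entrySide (isEven (suc y)) (rowTile (suc y) (suc s))) (previousGlue (suc y) (suc s)) ≡ 1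
    entry = trans (entryBond-rowTile (suc y) s (s≤s⁻¹ 1+s<w))
                  (trans (cong glueStrength read) (readGlue-strength (rowParity (suc y)) s (lowBits (suc y) s)))

  Filled : ℕ → ℕ → ℕ → Set
  Filled k x y = x < w × y < n × index x y < k

  filled? : ∀ k x y → Dec (Filled k x y)
  filled? k x y = x <? w ×-dec y <? n ×-dec index x y <? k

  stageTile : ℕ → ℕ → ℕ → Maybe TileType
  stageTile k x y with filled? k x y
  ... | yes _ = just (rowTile y (along x y))
  ... | no  _ = nothing

  -- The clause for negative rows comes first, so that it also fires when the
  -- column is not a constructor form (x + 1, x − 1).
  stage : ℕ → Assembly
  stage k (_ , -[1+ _ ])       = nothing
  stage k (+ x , + y)          = stageTile k x y
  stage k (-[1+ _ ] , + _)     = nothing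

  stageTile-filled : ∀ {k x y} → Filled k x y → stageTile k x y ≡ just (rowTile y (along x y))
  stageTile-filled {k} {x} {y} f with filled? k x y
  ... | yes _ = refl
  ... | no ¬f = contradiction f ¬f

  stageTile-unfilled : ∀ {k x y} → ¬ Filled k x y → stageTile k x y ≡ nothing
  stageTile-unfilled {k} {x} {y} ¬f with filled? k x y
  ... | yes f = contradiction f ¬f
  ... | no _  = refl

  stageTile-just : ∀ {k x y t} → stageTile k x y ≡ just t → Filled k x y × t ≡ rowTile y (along x y)
  stageTile-just {k} {x} {y} e with filled? k x y
  stageTile-just refl | yes f = f , refl
  stageTile-just ()   | no _

  stageTile-nothing : ∀ {k x y} → stageTile k x y ≡ nothing → ¬ Filled k x y
  stageTile-nothing {k} {x} {y} e with filled? k x y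
  stageTile-nothing () | yes _
  stageTile-nothing _  | no ¬f = ¬f

  k≤index : ∀ {k x y} → x < w → y < n → stageTile k x y ≡ nothing → k ≤ index x y
  k≤index x<w y<n e = ≮⇒≥ λ i<k → stageTile-nothing e (x<w , y<n , i<k)

  belowTile : ℕ → ℕ → ℕ → Maybe TileType
  belowTile k x zero    = nothing
  belowTile k x (suc y) = stageTile k x y

  leftTile : ℕ → ℕ → ℕ → Maybe TileType
  leftTile k zero    y = nothing
  leftTile k (suc x) y = stageTile k x y

  module _ (k x y : ℕ) (t : TileType) where
    northBond eastBond southBond westBond : ℕ
    northBond = bond 𝒯 (north t) (Maybe.map south (stageTile k x (suc y)))
    eastBond  = bond 𝒯 (east t)  (Maybe.map west  (stageTile k (suc x) y))
    southBond = bond 𝒯 (south t) (Maybe.map north (belowTile k x y))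
    westBond  = bond 𝒯 (west t)  (Maybe.map east  (leftTile k x y))

  strength-stage : ∀ k x y t →
    strength 𝒯 (stage k) (+ x , + y) t ≡ northBond k x y t + eastBond k x y t + southBond k x y t + westBond k x y t
  strength-stage k x y t = trans (unfold x y)
    (cong₂ (λ y′ x′ → bond 𝒯 (north t) (Maybe.map south (stageTile k x y′)) + bond 𝒯 (east t) (Maybe.map west (stageTile k x′ y))
                        + southBond k x y t + westBond k x y t) (+-comm y 1) (+-comm x 1))
    where
    unfold : ∀ x y → strength 𝒯 (stage k) (+ x , + y) t ≡
      bond 𝒯 (north t) (Maybe.map south (stageTile k x (y + 1))) + bond 𝒯 (east t) (Maybe.map west (stageTile k (x + 1) y))
        + southBond k x y t + westBond k x y t
    unfold zero    zero    = refl
    unfold zero    (suc y) = refl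
    unfold (suc x) zero    = refl
    unfold (suc x) (suc y) = refl

  Frontier : ℕ → ℕ → ℕ → Set
  Frontier k x y = x < w × y < n × index x y ≡ k

  northBond-free : ∀ {k x y} t → stageTile k x y ≡ nothing → northBond k x y t ≡ 0
  northBond-free {k} {x} {y} t e with stageTile k x (suc y) in e↑
  ... | nothing = refl
  ... | just _ with (x<w , 1+y<n , i<k) , _ ← stageTile-just e↑ =
    contradiction (x<w , <-trans (n<1+n y) 1+y<n , <-trans (index-vertical y x x<w) i<k) (stageTile-nothing e)

  eastBond-frontier : ∀ {k x y} t → stageTile k x y ≡ nothing → Frontier k x y ⊎ eastBond k x y t ≡ 0
  eastBond-frontier {k} {x} {y} t e with stageTile k (suc x) y in e→
  ... | nothing = inj₂ refl
  ... | just _ with (1+x<w , y<n , i<k) , _ ← stageTile-just e→ = inj₁ (x<w , y<n , bool-cases (isEven y) even odd)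
    where
    x<w = <-trans (n<1+n x) 1+x<w
    k≤i = k≤index x<w y<n e
    even : isEven y ≡ true → index x y ≡ k
    even ev = contradiction (subst (_< k) (index-suc-even x y ev) i<k) (≤⇒≯ (≤-trans k≤i (n≤1+n _)))
    odd : isEven y ≡ false → index x y ≡ k
    odd od = ≤-antisym (subst (_≤ k) (sym (index-suc-odd x y od 1+x<w)) i<k) k≤i

  eastEdge-tile : ∀ y → east (rowTile y (along last y)) ≡ eastEdge y
  eastEdge-tile y = trans (east-rowTile y (along last y)) (bool-cases (isEven y) even odd)
    where
    even : isEven y ≡ true → (if isEven y then exitGlue y (along last y) else entryGlue y (along last y)) ≡ eastEdge y
    even ev = trans (if-true ev) (trans (cong (exitGlue y) (along-even last y ev)) (trans (exitGlue-last y) (if-true ev)))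
    odd : isEven y ≡ false → (if isEven y then exitGlue y (along last y) else entryGlue y (along last y)) ≡ eastEdge y
    odd od = trans (if-false od) (trans (cong (entryGlue y) (along-last-odd y od)) (if-false od))

  westBond-frontier : ∀ {k x y} t → stageTile k x y ≡ nothing → Frontier k x y ⊎ westBond k x y t ≡ 0
  westBond-frontier {k} {zero}   {y} t e = inj₂ refl
  westBond-frontier {k} {suc x}  {y} t e with stageTile k x y in e←
  ... | nothing = inj₂ refl
  ... | just u with (x<w , y<n , i<k) , refl ← stageTile-just e← = by-width (suc x <? w)
    where
    by-width : Dec (suc x < w) → Frontier k (suc x) y ⊎ bond 𝒯 (west t) (just (east (rowTile y (along x y)))) ≡ 0
    by-width (yes 1+x<w) = inj₁ (1+x<w , y<n , bool-cases (isEven y) even odd)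
      where
      k≤i = k≤index 1+x<w y<n e
      even : isEven y ≡ true → index (suc x) y ≡ k
      even ev = ≤-antisym (subst (_≤ k) (sym (index-suc-even x y ev)) i<k) k≤i
      odd : isEven y ≡ false → index (suc x) y ≡ k
      odd od = contradiction (subst (_< k) (index-suc-odd x y od 1+x<w) i<k) (≤⇒≯ (≤-trans k≤i (n≤1+n _)))
    by-width (no 1+x≮w) = inj₂ (bond-weak 𝒯 (west t) _ (trans (cong glueStrength east≡) (eastEdge-strength y)))
      where
      east≡ : east (rowTile y (along x y)) ≡ eastEdge y
      east≡ = subst (λ x → east (rowTile y (along x y)) ≡ eastEdge y)
                    (sym (≤-antisym (s≤s⁻¹ x<w) (s≤s⁻¹ (≮⇒≥ 1+x≮w)))) (eastEdge-tile y)

  last∸a≡last : ∀ {a} → last ∸ a ≡ last → a ≡ 0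
  last∸a≡last {zero}  _ = refl
  last∸a≡last {suc a} e = contradiction e (last∸suc≢last a)

  southBond-frontier : ∀ {k x y} t → stageTile k x y ≡ nothing → 2 ≤ southBond k x y t → Frontier k x y
  southBond-frontier {k} {x} {zero}  t e ()
  southBond-frontier {k} {x} {suc y} t e 2≤ with stageTile k x y in e↓
  southBond-frontier {k} {x} {suc y} t e () | nothing
  ... | just u with (x<w , y<n , i<k) , refl ← stageTile-just e↓ =
    x<w , 1+y<n , ≤-antisym (subst (_≤ k) (sym (index-row-start y x<w starts)) i<k) (k≤index x<w 1+y<n e)
    where
    strong = northGlue-strong y (along x y)
               (subst (λ g → 2 ≤ glueStrength g) (north-rowTile y (along x y)) (≤-trans 2≤ (bond≤str 𝒯 (south t) _)))
    1+y<n : suc y < n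
    1+y<n = s≤s (≤∧≢⇒< (s≤s⁻¹ y<n) (does-false (y ≟ m) (proj₁ strong)))
    starts : along x (suc y) ≡ 0
    starts = last∸a≡last (trans (sym (along-vertical y x<w)) (proj₂ strong))

  -- The cell above and the cell ahead are still empty, the cell behind is filled
  -- only at the frontier (or offers a strength-0 edge glue), and a strength-2
  -- bond from below comes only from the end of the previous row.
  frontier : ∀ {k x y} t → stageTile k x y ≡ nothing →
             2 ≤ northBond k x y t + eastBond k x y t + southBond k x y t + westBond k x y t → Frontier k x y
  frontier t e 2≤ =
    [ id , (λ east≡0 → [ id , (λ west≡0 → southBond-frontier t e (2≤third (northBond-free t e) east≡0 west≡0 2≤)) ]′
                               (westBond-frontier t e)) ]′
      (eastBond-frontier t e)

  frontier-empty : ∀ {k x y} → Frontier k x y → stageTile k x y ≡ nothing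
  frontier-empty (_ , _ , i≡k) = stageTile-unfilled (λ (_ , _ , i<k) → <-irrefl i≡k i<k)

  southBond-at : ∀ {k x} y t → Frontier k x y → southBond k x y t ≡ bond 𝒯 (south t) (belowGlue y (along x y))
  southBond-at zero     t _                  = refl
  southBond-at {k} {x} (suc y) t (x<w , 1+y<n , i≡k) = trans
    (cong (λ g → bond 𝒯 (south t) (Maybe.map north g))
      (stageTile-filled (x<w , <-trans (n<1+n y) 1+y<n , subst (index x y <_) i≡k (index-vertical y x x<w))))
    (cong (λ g → bond 𝒯 (south t) (just g)) (trans (north-rowTile y (along x y)) (cong (northGlue y) (along-vertical y x<w))))

  eastBond-even : ∀ {k x y} t → isEven y ≡ true → Frontier k x y → eastBond k x y t ≡ 0
  eastBond-even {k} {x} {y} t ev (_ , _ , i≡k) = cong (λ g → bond 𝒯 (east t) (Maybe.map west g))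
    (stageTile-unfilled {k} {suc x} {y} (λ (_ , _ , i<k) → <-asym (subst (_< k) (trans (index-suc-even x y ev) (cong suc i≡k)) i<k) (n<1+n k)))

  westBond-even : ∀ {k x y} t → isEven y ≡ true → Frontier k x y →
                  westBond k x y t ≡ bond 𝒯 (entrySide (isEven y) t) (previousGlue y (along x y))
  westBond-even {k} {zero}  {y} t ev _ = cong (λ s → bond 𝒯 (entrySide (isEven y) t) (previousGlue y s)) (sym (along-even 0 y ev))
  westBond-even {k} {suc x} {y} t ev (1+x<w , y<n , i≡k) = begin
    bond 𝒯 (west t) (Maybe.map east (stageTile k x y))
      ≡⟨ cong (λ g → bond 𝒯 (west t) (Maybe.map east g))
              (stageTile-filled (<-trans (n<1+n x) 1+x<w , y<n , subst (index x y <_) (trans (sym (index-suc-even x y ev)) i≡k) (n<1+n _))) ⟩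
    bond 𝒯 (west t) (just (east (rowTile y (along x y))))
      ≡⟨ cong (λ g → bond 𝒯 (west t) (just g)) (trans (east-rowTile y (along x y)) (if-true ev)) ⟩
    bond 𝒯 (west t) (just (exitGlue y (along x y)))
      ≡⟨ cong₂ (λ b s → bond 𝒯 (entrySide b t) (previousGlue y s)) (sym ev) (sym (along-suc-even x y ev)) ⟩
    bond 𝒯 (entrySide (isEven y) t) (previousGlue y (along (suc x) y)) ∎
    where open ≡-Reasoning

  westBond-odd : ∀ {k x y} t → isEven y ≡ false → Frontier k x y → westBond k x y t ≡ 0
  westBond-odd {k} {zero}  {y} t od _ = refl
  westBond-odd {k} {suc x} {y} t od (1+x<w , _ , i≡k) = cong (λ g → bond 𝒯 (west t) (Maybe.map east g))
    (stageTile-unfilled {k} {x} {y} (λ (_ , _ , i<k) → <-asym (subst (_< k) (trans (index-suc-odd x y od 1+x<w) (cong suc i≡k)) i<k) (n<1+n k)))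

  eastBond-odd : ∀ {k x y} t → isEven y ≡ false → Frontier k x y →
                 eastBond k x y t ≡ bond 𝒯 (entrySide (isEven y) t) (previousGlue y (along x y))
  eastBond-odd {k} {x} {y} t od (x<w , y<n , i≡k) = by-width (suc x <? w)
    where
    open ≡-Reasoning
    by-width : Dec (suc x < w) → eastBond k x y t ≡ bond 𝒯 (entrySide (isEven y) t) (previousGlue y (along x y))
    by-width (yes 1+x<w) = begin
      bond 𝒯 (east t) (Maybe.map west (stageTile k (suc x) y))
        ≡⟨ cong (λ g → bond 𝒯 (east t) (Maybe.map west g))
                (stageTile-filled (1+x<w , y<n , subst (index (suc x) y <_) (trans (sym (index-suc-odd x y od 1+x<w)) i≡k) (n<1+n _))) ⟩
      bond 𝒯 (east t) (just (west (rowTile y (along (suc x) y))))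
        ≡⟨ cong (λ g → bond 𝒯 (east t) (just g)) (trans (west-rowTile y (along (suc x) y)) (if-false od)) ⟩
      bond 𝒯 (east t) (just (exitGlue y (along (suc x) y)))
        ≡⟨ cong₂ (λ b s → bond 𝒯 (entrySide b t) (previousGlue y s)) (sym od) (sym (along-suc-odd x y od 1+x<w)) ⟩
      bond 𝒯 (entrySide (isEven y) t) (previousGlue y (along x y)) ∎
    by-width (no 1+x≮w) = trans
      (cong (λ g → bond 𝒯 (east t) (Maybe.map west g)) (stageTile-unfilled {k} {suc x} {y} (λ (1+x<w , _) → 1+x≮w 1+x<w)))
      (cong (λ s → bond 𝒯 (entrySide (isEven y) t) (previousGlue y s))
        (sym (trans (cong (λ x → along x y) (≤-antisym (s≤s⁻¹ x<w) (s≤s⁻¹ (≮⇒≥ 1+x≮w)))) (along-last-odd y od))))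

  strength-frontier : ∀ {k x y} t → Frontier k x y → strength 𝒯 (stage k) (+ x , + y) t ≡ support y (along x y) t
  strength-frontier {k} {x} {y} t f =
    trans (strength-stage k x y t) (bool-cases (isEven y) even odd)
    where
    north≡0 = northBond-free t (frontier-empty f)
    even : isEven y ≡ true → northBond k x y t + eastBond k x y t + southBond k x y t + westBond k x y t ≡ support y (along x y) t
    even ev = cong₂ _+_ (trans (cong₂ (λ a b → a + b + southBond k x y t) north≡0 (eastBond-even t ev f)) (southBond-at y t f))
                        (westBond-even t ev f)
    odd : isEven y ≡ false → northBond k x y t + eastBond k x y t + southBond k x y t + westBond k x y t ≡ support y (along x y) t
    odd od = trans (cong₂ (λ a b → a + b) (cong₂ (λ a b → a + eastBond k x y t + b) north≡0 (southBond-at y t f)) (westBond-odd t od f))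
                   (trans (+-identityʳ _) (trans (+-comm (eastBond k x y t) _) (cong (_+_ _) (eastBond-odd t od f))))

  south-row₀ : ∀ {k x u} → stageTile k x 0 ≡ just u → south u ≡ 0
  south-row₀ {x = x} e with _ , refl ← stageTile-just e = trans (south-rowTile 0 (along x 0)) (southGlue-bottom (along x 0))

  west-column₀ : ∀ {k y u} → stageTile k 0 y ≡ just u → west u ≡ 0
  west-column₀ {y = y} e with _ , refl ← stageTile-just e = trans (west-rowTile y (along 0 y)) (bool-cases (isEven y) even odd)
    where
    even : isEven y ≡ true → (if isEven y then entryGlue y (along 0 y) else exitGlue y (along 0 y)) ≡ 0
    even ev = trans (if-true ev) (trans (cong (entryGlue y) (along-even 0 y ev)) (if-true ev))
    odd : isEven y ≡ false → (if isEven y then entryGlue y (along 0 y) else exitGlue y (along 0 y)) ≡ 0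
    odd od = trans (if-false od) (trans (cong (exitGlue y) (along-odd 0 y od)) (trans (exitGlue-last y) (if-false od)))

  bond-towards : ∀ g {side} {u : Maybe TileType} → (∀ {v} → u ≡ just v → side v ≡ 0) → bond 𝒯 g (Maybe.map side u) ≡ 0
  bond-towards g {u = nothing} _ = refl
  bond-towards g {u = just v}  z = bond-weak 𝒯 g _ (cong glueStrength (z refl))

  strength-outside : ∀ k i j t → strength 𝒯 (stage k) (i , j) t ≡ 0 ⊎ ∃ λ x → ∃ λ y → (i , j) ≡ (+ x , + y)
  strength-outside k (+ x)      (+ y)          t = inj₂ (x , y , refl)
  strength-outside k (+ x)      -[1+ suc j ]   t = inj₁ refl
  strength-outside k (+ x)      -[1+ zero ]    t =
    inj₁ (trans (+-identityʳ _) (trans (+-identityʳ _) (trans (+-identityʳ _) (bond-towards (north t) {south} {stageTile k x 0} south-row₀))))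
  strength-outside k -[1+ suc i ] (+ zero)     t = inj₁ refl
  strength-outside k -[1+ suc i ] (+ suc y)    t = inj₁ refl
  strength-outside k -[1+ zero ]  (+ zero)     t =
    inj₁ (trans (+-identityʳ _) (trans (+-identityʳ _) (bond-towards (east t) {west} {stageTile k 0 0} west-column₀)))
  strength-outside k -[1+ zero ]  (+ suc y)    t =
    inj₁ (trans (+-identityʳ _) (trans (+-identityʳ _) (bond-towards (east t) {west} {stageTile k 0 (suc y)} west-column₀)))
  strength-outside k -[1+ i ]   -[1+ zero ]    t = inj₁ refl
  strength-outside k -[1+ i ]   -[1+ suc j ]   t = inj₁ refl

  canAttach-stage : ∀ {k p t} → CanAttach 𝒯 (stage k) p t →
                    ∃ λ x → ∃ λ y → p ≡ (+ x , + y) × Frontier k x y × t ≡ rowTile y (along x y)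
  canAttach-stage {k} {i , j} {t} (t∈ , free , 2≤) with strength-outside k i j t
  ... | inj₁ ≡0 = contradiction (subst (2 ≤_) ≡0 2≤) λ ()
  ... | inj₂ (x , y , refl) =
    x , y , refl , f , support-determines (proj₁ (proj₂ f)) (along<w y (proj₁ f)) t∈ (subst (2 ≤_) (strength-frontier t f) 2≤)
    where f = frontier t free (subst (2 ≤_) (strength-stage k x y t) 2≤)

  N : ℕ
  N = n * w

  canAttach-only : ∀ {k p t} → CanAttach 𝒯 (stage k) p t → k < N × p ≡ cell k × t ≡ tileOfIndex k
  canAttach-only {k} {p} {t} c with x , y , refl , (x<w , y<n , refl) , refl ← canAttach-stage {k} {p} {t} c =
    index<size x<w y<n , sym (cell-index y x<w) , sym (cong₂ rowTile (proj₂ (index-divMod y x<w)) (proj₁ (index-divMod y x<w)))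

  frontier-cell : ∀ {k} → k < N → Frontier k (along (k % w) (k / w)) (k / w)
  frontier-cell {k} k<N = along<w (k / w) (m%n<n k w) , m<n*o⇒m/o<n k<N , index-cell k

  canAttach-next : ∀ {k} → 1 ≤ k → k < N → CanAttach 𝒯 (stage k) (cell k) (tileOfIndex k)
  canAttach-next {k} 1≤k k<N =
    rowTile∈tileTypes y<n (m%n<n k w) ,
    frontier-empty f ,
    subst (2 ≤_) (sym (strength-frontier (tileOfIndex k) f))
      (subst (λ s → 2 ≤ support y s (rowTile y (k % w))) (sym (along-involutive y (m%n<n k w)))
        (support-rowTile y<n (m%n<n k w) (subst (1 ≤_) (m≡m%n+[m/n]*n k w) 1≤k)))
    where
    f = frontier-cell k<N
    y = k / w
    y<n = proj₁ (proj₂ f)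

  stageTile-suc : ∀ {k x y} → (+ x , + y) ≢ cell k → stageTile k x y ≡ stageTile (suc k) x y
  stageTile-suc {k} {x} {y} ≢cell = by-filled (filled? (suc k) x y)
    where
    by-filled : Dec (Filled (suc k) x y) → stageTile k x y ≡ stageTile (suc k) x y
    by-filled (no ¬f) = trans (stageTile-unfilled (λ (x<w , y<n , i<k) → ¬f (x<w , y<n , <-trans i<k (n<1+n k))))
                              (sym (stageTile-unfilled ¬f))
    by-filled (yes f@(x<w , y<n , i<1+k)) with <-cmp (index x y) k
    ... | tri< i<k _ _ = trans (stageTile-filled (x<w , y<n , i<k)) (sym (stageTile-filled f))
    ... | tri≈ _ i≡k _ = contradiction (trans (sym (cell-index y x<w)) (cong cell i≡k)) ≢cell
    ... | tri> _ _ k<i = contradiction i<1+k (≤⇒≯ k<i)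

  place≗stage : ∀ {k} → k < N → place (stage k) (cell k) (tileOfIndex k) ≗ stage (suc k)
  place≗stage {k} k<N q with q ≟Pos cell k
  ... | yes refl = sym (trans (stageTile-filled (x<w , y<n , subst (_< suc k) (sym i≡k) (n<1+n k)))
                          (cong (λ s → just (rowTile (k / w) s)) (along-involutive (k / w) (m%n<n k w))))
    where
    f = frontier-cell k<N
    x<w = proj₁ f
    y<n = proj₁ (proj₂ f)
    i≡k = proj₂ (proj₂ f)
  ... | no q≢cell = agree q q≢cell
    where
    agree : ∀ q → q ≢ cell k → stage k q ≡ stage (suc k) q
    agree (_ , -[1+ _ ])      _     = refl
    agree (+ x , + y)         ≢cell = stageTile-suc ≢cell
    agree (-[1+ _ ] , + _)    _     = refl

  seed≗stage₁ : seedAssembly 𝒯 ≗ stage 1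
  seed≗stage₁ q with q ≟Pos (+ 0 , + 0)
  ... | yes refl = sym (stageTile-filled {1} {0} {0} (z<s , z<s , z<s))
  ... | no q≢0 = sym (agree q q≢0)
    where
    agree : ∀ q → q ≢ (+ 0 , + 0) → stage 1 q ≡ nothing
    agree (_ , -[1+ _ ])      _  = refl
    agree (-[1+ _ ] , + _)    _  = refl
    agree (+ x , + y)         ≢0 = stageTile-unfilled λ (x<w , _ , i<1) →
      let x≡0 , y≡0 = index-injective {x} {y} {0} {0} x<w z<s (n<1⇒n≡0 i<1) in ≢0 (cong₂ (λ x y → + x , + y) x≡0 y≡0)

  open SequentialAssembly 𝒯 N z<s stage cell tileOfIndex refl seed≗stage₁ place≗stage canAttach-next canAttach-only

  stage-shape : ∀ β → β ≗ stage N → HasShape β (Rect (+ 0) (+ 0) w n)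
  stage-shape β β≗ (i , j) = occupied⇒inside i j , inside⇒occupied i j
    where
    occupied⇒inside : ∀ i j → Occupied β (i , j) → Rect (+ 0) (+ 0) w n (i , j)
    occupied⇒inside i j (u , β≡u) with trans (sym (β≗ (i , j))) β≡u
    occupied⇒inside (+ x) (+ y) _ | e with (x<w , y<n , _) , _ ← stageTile-just e = ℤ.+≤+ z≤n , ℤ.+<+ x<w , ℤ.+≤+ z≤n , ℤ.+<+ y<n
    occupied⇒inside -[1+ _ ] (+ _) _ | ()
    occupied⇒inside _ -[1+ _ ]     _ | ()
    inside⇒occupied : ∀ i j → Rect (+ 0) (+ 0) w n (i , j) → Occupied β (i , j)
    inside⇒occupied (+ x) (+ y) (_ , ℤ.+<+ x<w , _ , ℤ.+<+ y<n) =
      rowTile y (along x y) , trans (β≗ (+ x , + y)) (stageTile-filled (x<w , y<n , index<size x<w y<n))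

  uniquelyAssembles-rectangle : UniquelyAssembles 𝒯 (Rect (+ 0) (+ 0) w n)
  uniquelyAssembles-rectangle = uniquelyAssembles stage-shape

  isZigZag-𝒯 : IsZigZag 𝒯
  isZigZag-𝒯 = isZigZag (λ k _ → cell-zigzag k)

  cornerTile : TileType
  cornerTile = rowTile m (along last m)

  east-cornerTile : east cornerTile ≡ 7
  east-cornerTile = trans (eastEdge-tile m) (if-true isTop-m)

  entryGlue-even≢7 : ∀ y s → isEven y ≡ true → entryGlue y s ≢ 7
  entryGlue-even≢7 y zero    ev = subst (_≢ 7) (sym (if-true ev)) λ ()
  entryGlue-even≢7 y (suc s) _  = link≢small y s ≤-refl

  exitGlue-odd≢7 : ∀ y s → isEven y ≡ false → exitGlue y s ≢ 7
  exitGlue-odd≢7 y s od = by-last (s ≟ last)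
    where
    by-last : Dec (s ≡ last) → exitGlue y s ≢ 7
    by-last (yes refl)    = subst (_≢ 7) (sym (trans (exitGlue-last y) (if-false od))) λ ()
    by-last (no s≢last)   = subst (_≢ 7) (sym (exitGlue-link y s s≢last)) (link≢small y s ≤-refl)

  entryGlue-odd≡7 : ∀ y s → isEven y ≡ false → entryGlue y s ≡ 7 → y ≡ m × s ≡ 0
  entryGlue-odd≡7 y zero    od e = isTop⇒≡m y (eastEdge≡7⇒isTop y (trans (sym (if-false od)) e)) , refl
  entryGlue-odd≡7 y (suc s) _  e = contradiction e (link≢small y s ≤-refl)

  exitGlue-even≡7 : ∀ y s → isEven y ≡ true → exitGlue y s ≡ 7 → y ≡ m × s ≡ last
  exitGlue-even≡7 y s ev e = by-last (s ≟ last)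
    where
    by-last : Dec (s ≡ last) → y ≡ m × s ≡ last
    by-last (yes s≡last) = isTop⇒≡m y (eastEdge≡7⇒isTop y (trans (sym (if-true ev))
                             (trans (sym (exitGlue-last y)) (subst (λ s → exitGlue y s ≡ 7) s≡last e)))) , s≡last
    by-last (no s≢last)  = contradiction (trans (sym (exitGlue-link y s s≢last)) e) (link≢small y s ≤-refl)

  west-rowTile≢7 : ∀ y s → west (rowTile y s) ≢ 7
  west-rowTile≢7 y s = subst (_≢ 7) (sym (west-rowTile y s)) (bool-cases (isEven y) even odd)
    where
    even : isEven y ≡ true → (if isEven y then entryGlue y s else exitGlue y s) ≢ 7
    even ev = subst (_≢ 7) (sym (if-true ev)) (entryGlue-even≢7 y s ev)
    odd : isEven y ≡ false → (if isEven y then entryGlue y s else exitGlue y s) ≢ 7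
    odd od = subst (_≢ 7) (sym (if-false od)) (exitGlue-odd≢7 y s od)

  east-rowTile≡7 : ∀ y s → east (rowTile y s) ≡ 7 → rowTile y s ≡ cornerTile
  east-rowTile≡7 y s e = bool-cases (isEven y) even odd
    where
    even : isEven y ≡ true → rowTile y s ≡ cornerTile
    even ev with refl , refl ← exitGlue-even≡7 y s ev (trans (sym (if-true ev)) (trans (sym (east-rowTile y s)) e)) =
      cong (rowTile m) (sym (along-even last m ev))
    odd : isEven y ≡ false → rowTile y s ≡ cornerTile
    odd od with refl , refl ← entryGlue-odd≡7 y s od (trans (sym (if-false od)) (trans (sym (east-rowTile y s)) e)) =
      cong (rowTile m) (sym (along-last-odd m od))

  onlyEastOf-cornerTile : OnlyEastOf 𝒯 7 cornerTile
  onlyEastOf-cornerTile = (λ ()) , east-cornerTile , λ u u∈ → sides u (tileTypes-inv u∈)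
    where
    sides : ∀ u → (∃ λ y → ∃ λ s → y < n × s < w × u ≡ rowTile y s) →
            north u ≢ 7 × south u ≢ 7 × west u ≢ 7 × (east u ≡ 7 → u ≡ cornerTile)
    sides _ (y , s , _ , _ , refl) =
      (λ e → <⇒≢ (northGlue<7 y s) (trans (sym (north-rowTile y s)) e)) ,
      (λ e → <⇒≢ (southGlue<7 y s) (trans (sym (south-rowTile y s)) e)) ,
      west-rowTile≢7 y s ,
      east-rowTile≡7 y s

  terminal-corner : ∀ β → Produced 𝒯 β → Terminal 𝒯 β →
                    ∃ λ t → β (neCorner (+ 0) (+ 0) w n) ≡ just t × OnlyEastOf 𝒯 7 t
  terminal-corner β prod term =
    cornerTile ,
    trans (terminal-final (produced-stage prod) term (+ last , + m))
          (stageTile-filled (≤-refl , ≤-refl , index<size {last} {m} {n} ≤-refl ≤-refl)) ,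
    onlyEastOf-cornerTile

  #nsGlues≤7 : #nsGlues 𝒯 ≤ 7
  #nsGlues≤7 = length-deduplicate≤ 7 _ (All.tabulate ns<7)
    where
    ns<7 : ∀ {g} → g ∈ map north tileTypes ++ map south tileTypes → g < 7
    ns<7 g∈ with ∈-++⁻ (map north tileTypes) g∈
    ... | inj₁ g∈N with u , u∈ , refl ← ∈-map⁻ north g∈N with y , s , _ , _ , refl ← tileTypes-inv u∈ =
      subst (_< 7) (sym (north-rowTile y s)) (northGlue<7 y s)
    ... | inj₂ g∈S with u , u∈ , refl ← ∈-map⁻ south g∈S with y , s , _ , _ , refl ← tileTypes-inv u∈ =
      subst (_< 7) (sym (south-rowTile y s)) (southGlue<7 y s)

width≤ : ∀ l → suc (suc (suc l + suc l)) ≤ 8 * (l + 1)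
width≤ l = subst (suc (suc (suc l + suc l)) ≤_) (eq l) (m≤m+n _ (6 * l + 4))
  where
  eq : ∀ l → suc (suc (suc l + suc l)) + (6 * l + 4) ≡ 8 * (l + 1)
  eq = solve-∀

lemma1 : ∃ λ (c : ℕ) → ∀ (n : ℕ) → 1 ≤ n →
    ∃ λ (𝒯 : TileSystem) → ∃ λ (w : ℕ) → ∃ λ (a : ℤ) → ∃ λ (b : ℤ) →
      (τ 𝒯 ≡ 2) × IsZigZag 𝒯 × (#nsGlues 𝒯 ≤ c) ×
      (w ≤ c * (⌊log₂ n ⌋ + 1)) ×
      UniquelyAssembles 𝒯 (Rect a b w n) ×
      ∃ λ (γ : Glue) → ∀ β → Produced 𝒯 β → Terminal 𝒯 β →
        ∃ λ t → (β (neCorner a b w n) ≡ just t) × OnlyEastOf 𝒯 γ t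
lemma1 = 8 , λ where
  (suc m) _ → let open Rectangle m ⌊log₂ suc m ⌋ (n<2^[1+⌊log₂n⌋] (suc m)) in
    𝒯 , w , + 0 , + 0 , refl , isZigZag-𝒯 , ≤-trans #nsGlues≤7 (n≤1+n 7) , width≤ ⌊log₂ suc m ⌋ ,
    uniquelyAssembles-rectangle , 7 , terminal-corner
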